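{- For a Chomp board $B$ (a finite set of cells $(x,y)$, $x,y$ positive integers, such that $(x,y)\in B$, $1\le p\le x$, $1\le q\le y$ imply $(p,q)\in B$), let $\mathbb{E}[B]$ denote the expected number of turns of random Chomp started from $B$ (each turn the player to move chooses a cell $(x,y)$ of the current board uniformly at random, independently, and removes all cells $(p,q)$ with $p\ge x$, $q\ge y$; the game ends when the board is empty). Let $H_N=\sum_{j=1}^N \frac1j$. There is a function $\varepsilon(N)$ with $\varepsilon(N)\to0$ as $N\to\infty$ such that every Chomp board $B$ with $N$ cells satisfies \[ H_N \le \mathbb{E}[B] \le \left(\tfrac12+\varepsilon(N)\right) H_N^2 . \] Moreover, there are boards having $N$ cells attaining these lower and upper bounds.
   Context: Cells are indexed by row $x$ and column $y$, with $(1,1)$ the top-left cell. -}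

module Defs where

open import Data.Nat using (ℕ; zero; suc; _≤ᵇ_) renaming (_≤_ to _≤ℕ_)
open import Data.Bool using (not; _∧_)
open import Data.Product using (_×_; _,_)
open import Data.List using (List; []; _∷_; length; filterᵇ)
open import Data.List.Membership.Propositional using (_∈_)
open import Data.List.Relation.Unary.Unique.Propositional using (Unique)
open import Data.List.Relation.Unary.All using (All)
open import Data.Integer using (+_)
open import Data.Rational using (ℚ; 0ℚ; 1ℚ; _+_; _*_; _/_)

-- A cell (x , y): x = row, y = column (both positive integers).
Cell : Set
Cell = ℕ × ℕ

Positive : Cell → Set
Positive (x , y) = (1 ≤ℕ x) × (1 ≤ℕ y)

IsBoard : List Cell → Set
IsBoard B =
  Unique B × All Positive B ×
  (∀ x y p q → (x , y) ∈ B → 1 ≤ℕ p → p ≤ℕ x → 1 ≤ℕ q → q ≤ℕ y → (p , q) ∈ B)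

chomp : Cell → List Cell → List Cell
chomp (x , y) = filterᵇ (λ { (p , q) → not ((x ≤ᵇ p) ∧ (y ≤ᵇ q)) })

-- Expected number of turns, with fuel (each move removes the chosen cell,
-- so fuel = number of cells suffices).
-- E[∅] = 0,  E[B] = 1 + (1/|B|) Σ_{c ∈ B} E[chomp c B].
mutual
  Efuel : ℕ → List Cell → ℚ
  Efuel zero    _          = 0ℚ
  Efuel (suc f) []         = 0ℚ
  Efuel (suc f) B@(c ∷ cs) = 1ℚ + ((+ 1 / length (c ∷ cs)) * sumE f B B)

  sumE : ℕ → List Cell → List Cell → ℚ
  sumE f B []       = 0ℚ
  sumE f B (c ∷ cs) = Efuel f (chomp c B) + sumE f B cs

E : List Cell → ℚ
E B = Efuel (length B) B

H : ℕ → ℚ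
H zero    = 0ℚ
H (suc n) = H n + (+ 1 / suc n)

-- A cell (x , y) of B is picked (rather than eaten) iff it is picked before the other cells
-- of the x × y rectangle below it, so E B = Σ_{(x , y) ∈ B} 1 / (x y); here this is verified
-- directly against the recursion defining E. Since x y ≤ N for every cell, deleting a corner
-- cell loses weight at least 1/N, which gives H N by induction; a single row attains it. For
-- the upper bound, B lies inside the hyperbola {x y ≤ N}, whose weight Σ_x H (N / x) / x is at
-- most ½ H N² + H N. The hyperbola {x y ≤ N / ℓ} with ℓ ≈ log₂ N has at most N cells and
-- weight ½ H N² - O(H N · log log N); padding its first row gives boards of N cells with
-- E ≥ (½ - ε N) H N².

module Submission where

open import Defs
open import Data.Nat as ℕ using (ℕ; zero; suc; _^_; _∸_; _≤ᵇ_) renaming (_≤_ to _≤ℕ_; _<_ to _<ℕ_)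
import Data.Nat.Properties as ℕP
open import Data.Nat.DivMod using (m*n/n≡m; m/n*n≤m; m/n≤m; /-monoˡ-≤; m≡m%n+[m/n]*n; m%n<n)
open import Data.Integer as ℤ using (+[1+_]; -[1+_]; +≤+)
import Data.Integer.Properties as ℤP
open import Data.Rational using (ℚ; mkℚ; 0ℚ; 1ℚ; ½; _+_; _-_; _*_; _/_; _≤_; _<_; -_; ∣_∣; nonNegative; positive; toℚᵘ)
open import Data.Rational.Properties
import Data.Rational.Unnormalised as U
import Data.Rational.Unnormalised.Properties as UP
open import Data.Rational.Solver
open +-*-Solver using (solve; _:+_; _:*_; _:-_; _:=_; :-_; con)
open import Data.Bool using (Bool; true; false; if_then_else_; T; not; _∧_)
open import Data.Bool.Properties using (T-∧)
open import Data.List using (List; []; _∷_; _++_; [_]; length; filterᵇ; map; cartesianProduct; applyUpTo)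
open import Data.List.Properties using (length-++; length-map; length-applyUpTo; applyUpTo-∷ʳ; filter-notAll)
open import Data.List.Membership.Propositional using (_∈_; _∉_)
open import Data.List.Membership.Propositional.Properties
  using (∈-∃++; ∈-++⁻; ∈-++⁺ˡ; ∈-++⁺ʳ; ∈-map⁺; ∈-map⁻; ∈-filter⁺; ∈-filter⁻; ∈-applyUpTo⁺; ∈-applyUpTo⁻;
         ∈-cartesianProduct⁺; ∈-cartesianProduct⁻)
open import Data.List.Relation.Unary.Any using (Any; here; there)
open import Data.List.Relation.Unary.All as All using (All; []; _∷_)
open import Data.List.Relation.Unary.AllPairs using (_∷_)
open import Data.List.Relation.Unary.Unique.Propositional using (Unique)
import Data.List.Relation.Unary.Unique.Propositional.Properties as Unique
open import Data.List.Extrema ℕP.≤-totalOrder using (argmax; argmax-sel; f[⊥]≤f[argmax]; f[xs]≤f[argmax])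
open import Data.Product using (Σ; ∃; _×_; _,_; proj₁; proj₂)
open import Data.Sum using (inj₁; inj₂)
open import Function using (_∘_; Equivalence)
open import Relation.Nullary using (¬_; yes; no; contradiction)
open import Relation.Nullary.Decidable using (T?)
open import Relation.Binary.PropositionalEquality hiding ([_])

⟦_⟧ : ℕ → ℚ

⟦ n ⟧ = ℤ.+ n / 1

-- 1/n, with the junk value 1/0 = 0.
inv : ℕ → ℚ
inv zero = 0ℚ
inv (suc k) = ℤ.+ 1 / suc k

private
  toℚᵘ-/ : ∀ m k → toℚᵘ (ℤ.+ m / suc k) U.≃ U.mkℚᵘ (ℤ.+ m) k
  toℚᵘ-/ m k = toℚᵘ-fromℚᵘ (U.mkℚᵘ (ℤ.+ m) k)

⟦⟧-+ : ∀ m n → ⟦ m ℕ.+ n ⟧ ≡ ⟦ m ⟧ + ⟦ n ⟧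
⟦⟧-+ m n = toℚᵘ-injective (UP.≃-trans (toℚᵘ-/ (m ℕ.+ n) 0)
  (UP.≃-trans (U.*≡* eq) (UP.≃-sym (UP.≃-trans (toℚᵘ-homo-+ ⟦ m ⟧ ⟦ n ⟧) (UP.+-cong (toℚᵘ-/ m 0) (toℚᵘ-/ n 0))))))
  where
  eq : (ℤ.+ (m ℕ.+ n)) ℤ.* (ℤ.+ 1) ≡ ((ℤ.+ m) ℤ.* (ℤ.+ 1) ℤ.+ (ℤ.+ n) ℤ.* (ℤ.+ 1)) ℤ.* (ℤ.+ 1)
  eq rewrite ℤP.*-identityʳ (ℤ.+ m) | ℤP.*-identityʳ (ℤ.+ n) | ℤP.*-identityʳ (ℤ.+ m ℤ.+ ℤ.+ n) = refl

⟦⟧-* : ∀ m n → ⟦ m ℕ.* n ⟧ ≡ ⟦ m ⟧ * ⟦ n ⟧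
⟦⟧-* m n = toℚᵘ-injective (UP.≃-trans (toℚᵘ-/ (m ℕ.* n) 0)
  (UP.≃-trans (U.*≡* eq) (UP.≃-sym (UP.≃-trans (toℚᵘ-homo-* ⟦ m ⟧ ⟦ n ⟧) (UP.*-cong (toℚᵘ-/ m 0) (toℚᵘ-/ n 0))))))
  where
  eq : (ℤ.+ (m ℕ.* n)) ℤ.* (ℤ.+ 1) ≡ ((ℤ.+ m) ℤ.* (ℤ.+ n)) ℤ.* (ℤ.+ 1)
  eq rewrite ℤP.*-identityʳ (ℤ.+ m ℤ.* ℤ.+ n) | ℤP.*-identityʳ (ℤ.+ (m ℕ.* n)) | ℤP.pos-* m n = refl

⟦⟧-suc : ∀ n → ⟦ suc n ⟧ ≡ ⟦ n ⟧ + 1ℚ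
⟦⟧-suc n = trans (⟦⟧-+ 1 n) (+-comm 1ℚ ⟦ n ⟧)

⟦⟧-mono-≤ : ∀ {m n} → m ≤ℕ n → ⟦ m ⟧ ≤ ⟦ n ⟧
⟦⟧-mono-≤ {m} {n} m≤n = toℚᵘ-cancel-≤ (UP.≤-respˡ-≃ (UP.≃-sym (toℚᵘ-/ m 0)) (UP.≤-respʳ-≃ (UP.≃-sym (toℚᵘ-/ n 0))
  (U.*≤* (ℤP.*-monoʳ-≤-nonNeg (ℤ.+ 1) (+≤+ m≤n)))))

⟦⟧-cancel-≤ : ∀ {m n} → ⟦ m ⟧ ≤ ⟦ n ⟧ → m ≤ℕ n
⟦⟧-cancel-≤ {m} {n} h with UP.≤-respˡ-≃ (toℚᵘ-/ m 0) (UP.≤-respʳ-≃ (toℚᵘ-/ n 0) (toℚᵘ-mono-≤ h))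
... | U.*≤* p = ℤP.drop‿+≤+ (ℤP.*-cancelʳ-≤-pos (ℤ.+ m) (ℤ.+ n) (ℤ.+ 1) p)

⟦⟧-nonNeg : ∀ n → 0ℚ ≤ ⟦ n ⟧
⟦⟧-nonNeg n = ⟦⟧-mono-≤ {0} {n} ℕ.z≤n

inv-inverseˡ : ∀ k → inv (suc k) * ⟦ suc k ⟧ ≡ 1ℚ
inv-inverseˡ k = toℚᵘ-injective (UP.≃-trans (toℚᵘ-homo-* (inv (suc k)) ⟦ suc k ⟧)
  (UP.≃-trans (UP.*-cong (toℚᵘ-/ 1 k) (toℚᵘ-/ (suc k) 0)) (U.*≡* eq)))
  where
  eq : (ℤ.+ 1 ℤ.* ℤ.+ suc k) ℤ.* ℤ.+ 1 ≡ ℤ.+ 1 ℤ.* (ℤ.+ suc k ℤ.* ℤ.+ 1)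
  eq = trans (trans (ℤP.*-identityʳ (ℤ.+ 1 ℤ.* ℤ.+ suc k)) (ℤP.*-identityˡ (ℤ.+ suc k)))
             (sym (trans (ℤP.*-identityˡ (ℤ.+ suc k ℤ.* ℤ.+ 1)) (ℤP.*-identityʳ (ℤ.+ suc k))))

inv-inverseʳ : ∀ k → ⟦ suc k ⟧ * inv (suc k) ≡ 1ℚ
inv-inverseʳ k = trans (*-comm ⟦ suc k ⟧ (inv (suc k))) (inv-inverseˡ k)

inv-nonNeg : ∀ n → 0ℚ ≤ inv n
inv-nonNeg zero = ≤-refl
inv-nonNeg (suc k) = toℚᵘ-cancel-≤ (UP.≤-respʳ-≃ (UP.≃-sym (toℚᵘ-/ 1 k)) (U.*≤* (+≤+ ℕ.z≤n)))

inv-antimono-≤ : ∀ {j k} → suc j ≤ℕ suc k → inv (suc k) ≤ inv (suc j)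
inv-antimono-≤ {j} {k} le = toℚᵘ-cancel-≤ (UP.≤-respˡ-≃ (UP.≃-sym (toℚᵘ-/ 1 k)) (UP.≤-respʳ-≃ (UP.≃-sym (toℚᵘ-/ 1 j))
  (U.*≤* (ℤP.*-monoˡ-≤-nonNeg (ℤ.+ 1) (+≤+ le)))))

inv≤1 : ∀ n → inv n ≤ 1ℚ
inv≤1 zero = inv-nonNeg 1
inv≤1 (suc k) = inv-antimono-≤ {0} {k} (ℕ.s≤s ℕ.z≤n)

*-inverse-unique : ∀ x y p → x * p ≡ 1ℚ → y * p ≡ 1ℚ → x ≡ y
*-inverse-unique x y p xp≡1 yp≡1 = begin
  x            ≡⟨ sym (*-identityʳ x) ⟩
  x * 1ℚ       ≡⟨ cong (x *_) (sym yp≡1) ⟩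
  x * (y * p)  ≡⟨ solve 3 (λ x y p → x :* (y :* p) := y :* (x :* p)) refl x y p ⟩
  y * (x * p)  ≡⟨ cong (y *_) xp≡1 ⟩
  y * 1ℚ       ≡⟨ *-identityʳ y ⟩
  y            ∎
  where open ≡-Reasoning

inv-* : ∀ m n → inv (m ℕ.* n) ≡ inv m * inv n
inv-* zero n = sym (*-zeroˡ (inv n))
inv-* (suc a) zero rewrite ℕP.*-zeroʳ a = sym (*-zeroʳ (inv (suc a)))
inv-* (suc a) (suc b) = *-inverse-unique _ _ ⟦ suc a ℕ.* suc b ⟧ (inv-inverseˡ (b ℕ.+ a ℕ.* suc b)) (begin
  (inv (suc a) * inv (suc b)) * ⟦ suc a ℕ.* suc b ⟧       ≡⟨ cong (inv (suc a) * inv (suc b) *_) (⟦⟧-* (suc a) (suc b)) ⟩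
  (inv (suc a) * inv (suc b)) * (⟦ suc a ⟧ * ⟦ suc b ⟧)   ≡⟨ solve 4 (λ p q r s → (p :* q) :* (r :* s) := (p :* r) :* (q :* s)) refl
                                                              (inv (suc a)) (inv (suc b)) ⟦ suc a ⟧ ⟦ suc b ⟧ ⟩
  (inv (suc a) * ⟦ suc a ⟧) * (inv (suc b) * ⟦ suc b ⟧)   ≡⟨ cong₂ _*_ (inv-inverseˡ a) (inv-inverseˡ b) ⟩
  1ℚ                                                      ∎)
  where open ≡-Reasoning

⟦⟧*inv-*-cancel : ∀ a b → ⟦ suc a ⟧ * inv (suc a ℕ.* b) ≡ inv b
⟦⟧*inv-*-cancel a b = begin
  ⟦ suc a ⟧ * inv (suc a ℕ.* b)        ≡⟨ cong (⟦ suc a ⟧ *_) (inv-* (suc a) b) ⟩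
  ⟦ suc a ⟧ * (inv (suc a) * inv b)    ≡⟨ sym (*-assoc ⟦ suc a ⟧ (inv (suc a)) (inv b)) ⟩
  (⟦ suc a ⟧ * inv (suc a)) * inv b    ≡⟨ cong (_* inv b) (inv-inverseʳ a) ⟩
  1ℚ * inv b                           ≡⟨ *-identityˡ (inv b) ⟩
  inv b                                ∎
  where open ≡-Reasoning

inv-antimono-≤′ : ∀ {m n} → 1 ≤ℕ m → m ≤ℕ n → inv n ≤ inv m
inv-antimono-≤′ {suc m} {suc n} _ m≤n = inv-antimono-≤ m≤n

0≤* : ∀ {p q} → 0ℚ ≤ p → 0ℚ ≤ q → 0ℚ ≤ p * q
0≤* {p} {q} 0≤p 0≤q = ≤-trans (≤-reflexive (sym (*-zeroˡ q))) (*-monoʳ-≤-nonNeg q {{nonNegative 0≤q}} 0≤p)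

*-monoˡ-≤-0≤ : ∀ {p q} r → 0ℚ ≤ r → p ≤ q → r * p ≤ r * q
*-monoˡ-≤-0≤ r 0≤r = *-monoˡ-≤-nonNeg r {{nonNegative 0≤r}}

*-monoʳ-≤-0≤ : ∀ {p q} r → 0ℚ ≤ r → p ≤ q → p * r ≤ q * r
*-monoʳ-≤-0≤ r 0≤r = *-monoʳ-≤-nonNeg r {{nonNegative 0≤r}}

+≤⇒≤- : ∀ {a b c} → a + b ≤ c → b ≤ c - a
+≤⇒≤- {a} {b} {c} a+b≤c = ≤-trans (≤-reflexive (solve 2 (λ a b → b := (a :+ b) :- a) refl a b)) (+-monoˡ-≤ (- a) a+b≤c)

≤+⇒-≤ : ∀ {a b c} → c ≤ a + b → c - a ≤ b
≤+⇒-≤ {a} {b} {c} c≤a+b = ≤-trans (+-monoˡ-≤ (- a) c≤a+b) (≤-reflexive (solve 2 (λ a b → (a :+ b) :- a := b) refl a b))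

0≤½ : 0ℚ ≤ ½
0≤½ = inv-nonNeg 2

sq-mono-≤ : ∀ {a b} → 0ℚ ≤ a → a ≤ b → a * a ≤ b * b
sq-mono-≤ {a} {b} 0≤a a≤b = ≤-trans (*-monoˡ-≤-0≤ a 0≤a a≤b) (*-monoʳ-≤-0≤ b (≤-trans 0≤a a≤b) a≤b)

-- If l ≤ n then ½ n² - n l ≤ ½ (n - l)² ≤ ½ k²; otherwise the left side is at most 0.
½n²-nl≤½k² : ∀ n l k → 0ℚ ≤ n → 0ℚ ≤ l → 0ℚ ≤ k → n ≤ k + l → ½ * (n * n) - n * l ≤ ½ * (k * k)
½n²-nl≤½k² n l k 0≤n 0≤l 0≤k n≤k+l with ≤-total l n
... | inj₁ l≤n = begin
  ½ * (n * n) - n * l                        ≡⟨ solve 2 (λ n l → con ½ :* (n :* n) :- n :* l := con ½ :* ((n :- l) :* (n :- l)) :- con ½ :* (l :* l)) refl n l ⟩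
  ½ * ((n - l) * (n - l)) - ½ * (l * l)      ≤⟨ +-mono-≤ (*-monoˡ-≤-0≤ ½ 0≤½ (sq-mono-≤ 0≤n-l (≤+⇒-≤ (≤-trans n≤k+l (≤-reflexive (+-comm k l))))))
                                                         (neg-antimono-≤ (0≤* 0≤½ (0≤* 0≤l 0≤l))) ⟩
  ½ * (k * k) - 0ℚ                           ≡⟨ +-identityʳ _ ⟩
  ½ * (k * k)                                ∎
  where
  open ≤-Reasoning
  0≤n-l : 0ℚ ≤ n - l
  0≤n-l = ≤-trans (≤-reflexive (sym (+-inverseʳ l))) (+-monoˡ-≤ (- l) l≤n)
... | inj₂ n≤l = begin
  ½ * (n * n) - n * l                        ≤⟨ +-monoʳ-≤ (½ * (n * n)) (neg-antimono-≤ (*-monoˡ-≤-0≤ n 0≤n n≤l)) ⟩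
  ½ * (n * n) - n * n                        ≡⟨ solve 1 (λ n → con ½ :* (n :* n) :- n :* n := :- (con ½ :* (n :* n))) refl n ⟩
  - (½ * (n * n))                            ≤⟨ neg-antimono-≤ (0≤* 0≤½ (0≤* 0≤n 0≤n)) ⟩
  - 0ℚ                                       ≤⟨ 0≤* 0≤½ (0≤* 0≤k 0≤k) ⟩
  ½ * (k * k)                                ∎
  where open ≤-Reasoning

∃inv≤ : ∀ δ → 0ℚ < δ → ∃ λ d → inv (suc d) ≤ δ
∃inv≤ (mkℚ +[1+ p ] d _) _ = d , toℚᵘ-cancel-≤ (UP.≤-respˡ-≃ (UP.≃-sym (toℚᵘ-fromℚᵘ (U.mkℚᵘ (ℤ.+ 1) d)))
  (U.*≤* (ℤP.*-monoʳ-≤-nonNeg (ℤ.+ suc d) {ℤ.+ 1} {+[1+ p ]} (+≤+ (ℕ.s≤s ℕ.z≤n)))))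
∃inv≤ (mkℚ (ℤ.+ zero) d _) 0<δ with () ← positive 0<δ
∃inv≤ (mkℚ -[1+ p ] d _) 0<δ with () ← positive 0<δ

∑ : {A : Set} → List A → (A → ℚ) → ℚ
∑ []       f = 0ℚ
∑ (x ∷ xs) f = f x + ∑ xs f

module _ {A : Set} where

  ∑-++ : ∀ (xs ys : List A) f → ∑ (xs ++ ys) f ≡ ∑ xs f + ∑ ys f
  ∑-++ []       ys f = sym (+-identityˡ _)
  ∑-++ (x ∷ xs) ys f = trans (cong (f x +_) (∑-++ xs ys f)) (sym (+-assoc (f x) (∑ xs f) (∑ ys f)))

  ∑-cong : ∀ (xs : List A) {f g} → (∀ x → x ∈ xs → f x ≡ g x) → ∑ xs f ≡ ∑ xs g
  ∑-cong []       f≡g = refl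
  ∑-cong (x ∷ xs) f≡g = cong₂ _+_ (f≡g x (here refl)) (∑-cong xs (λ y y∈xs → f≡g y (there y∈xs)))

  ∑-mono-≤ : ∀ (xs : List A) {f g} → (∀ x → x ∈ xs → f x ≤ g x) → ∑ xs f ≤ ∑ xs g
  ∑-mono-≤ []       f≤g = ≤-refl
  ∑-mono-≤ (x ∷ xs) f≤g = +-mono-≤ (f≤g x (here refl)) (∑-mono-≤ xs (λ y y∈xs → f≤g y (there y∈xs)))

  ∑-nonNeg : ∀ (xs : List A) {f} → (∀ x → 0ℚ ≤ f x) → 0ℚ ≤ ∑ xs f
  ∑-nonNeg []       f≥0 = ≤-refl
  ∑-nonNeg (x ∷ xs) f≥0 = +-mono-≤ {0ℚ} {_} {0ℚ} (f≥0 x) (∑-nonNeg xs f≥0)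

  ∑-+ : ∀ (xs : List A) f g → ∑ xs (λ x → f x + g x) ≡ ∑ xs f + ∑ xs g
  ∑-+ []       f g = refl
  ∑-+ (x ∷ xs) f g = trans (cong (f x + g x +_) (∑-+ xs f g))
    (solve 4 (λ a b c d → (a :+ b) :+ (c :+ d) := (a :+ c) :+ (b :+ d)) refl (f x) (g x) (∑ xs f) (∑ xs g))

  ∑-*ˡ : ∀ (xs : List A) c f → ∑ xs (λ x → c * f x) ≡ c * ∑ xs f
  ∑-*ˡ []       c f = sym (*-zeroʳ c)
  ∑-*ˡ (x ∷ xs) c f = trans (cong (c * f x +_) (∑-*ˡ xs c f)) (sym (*-distribˡ-+ c (f x) (∑ xs f)))

  ∑-neg : ∀ (xs : List A) f → ∑ xs (λ x → - f x) ≡ - ∑ xs f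
  ∑-neg []       f = refl
  ∑-neg (x ∷ xs) f = trans (cong (- f x +_) (∑-neg xs f)) (sym (neg-distrib-+ (f x) (∑ xs f)))

  ∑-- : ∀ (xs : List A) f g → ∑ xs (λ x → f x - g x) ≡ ∑ xs f - ∑ xs g
  ∑-- xs f g = trans (∑-+ xs f (λ x → - g x)) (cong (∑ xs f +_) (∑-neg xs g))

  ∑-const : ∀ (xs : List A) c → ∑ xs (λ _ → c) ≡ ⟦ length xs ⟧ * c
  ∑-const []       c = sym (*-zeroˡ c)
  ∑-const (x ∷ xs) c = begin
    c + ∑ xs (λ _ → c)            ≡⟨ cong (c +_) (∑-const xs c) ⟩
    c + ⟦ length xs ⟧ * c         ≡⟨ solve 2 (λ c n → c :+ n :* c := (con 1ℚ :+ n) :* c) refl c ⟦ length xs ⟧ ⟩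
    (1ℚ + ⟦ length xs ⟧) * c      ≡⟨ cong (_* c) (sym (⟦⟧-+ 1 (length xs))) ⟩
    ⟦ suc (length xs) ⟧ * c       ∎
    where open ≡-Reasoning

  ∑-count : ∀ (xs : List A) → ∑ xs (λ _ → 1ℚ) ≡ ⟦ length xs ⟧
  ∑-count xs = trans (∑-const xs 1ℚ) (*-identityʳ _)

  ∑-zero : ∀ (xs : List A) → ∑ xs (λ _ → 0ℚ) ≡ 0ℚ
  ∑-zero []       = refl
  ∑-zero (x ∷ xs) = trans (+-identityˡ _) (∑-zero xs)

  ∑-filterᵇ : ∀ (p : A → Bool) (xs : List A) f → ∑ (filterᵇ p xs) f ≡ ∑ xs (λ x → if p x then f x else 0ℚ)
  ∑-filterᵇ p []       f = refl
  ∑-filterᵇ p (x ∷ xs) f with p x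
  ... | true  = cong (f x +_) (∑-filterᵇ p xs f)
  ... | false = trans (∑-filterᵇ p xs f) (sym (+-identityˡ _))

∑-comm : {A B : Set} (xs : List A) (ys : List B) (f : A → B → ℚ) →
         ∑ xs (λ x → ∑ ys (f x)) ≡ ∑ ys (λ y → ∑ xs (λ x → f x y))
∑-comm []       ys f = sym (∑-zero ys)
∑-comm (x ∷ xs) ys f = trans (cong (∑ ys (f x) +_) (∑-comm xs ys f)) (sym (∑-+ ys (f x) (λ y → ∑ xs (λ x → f x y))))

∑-map : {A B : Set} (g : A → B) (xs : List A) (f : B → ℚ) → ∑ (map g xs) f ≡ ∑ xs (λ x → f (g x))
∑-map g []       f = refl
∑-map g (x ∷ xs) f = cong (f (g x) +_) (∑-map g xs f)

∑-cartesianProduct : {A B : Set} (xs : List A) (ys : List B) (f : A × B → ℚ) →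
                     ∑ (cartesianProduct xs ys) f ≡ ∑ xs (λ x → ∑ ys (λ y → f (x , y)))
∑-cartesianProduct []       ys f = refl
∑-cartesianProduct (x ∷ xs) ys f = trans (∑-++ (map (x ,_) ys) (cartesianProduct xs ys) f)
  (cong₂ _+_ (∑-map (x ,_) ys f) (∑-cartesianProduct xs ys f))

module _ {A : Set} where

  ∈-delete : ∀ {v d : A} (us vs : List A) → d ∈ us ++ v ∷ vs → d ≢ v → d ∈ us ++ vs
  ∈-delete us vs d∈ d≢v with ∈-++⁻ us d∈
  ... | inj₁ d∈us          = ∈-++⁺ˡ d∈us
  ... | inj₂ (here d≡v)    = contradiction d≡v d≢v
  ... | inj₂ (there d∈vs)  = ∈-++⁺ʳ us d∈vs

  ∈-insert : ∀ {v d : A} (us vs : List A) → d ∈ us ++ vs → d ∈ us ++ v ∷ vs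
  ∈-insert us vs d∈ with ∈-++⁻ us d∈
  ... | inj₁ d∈us = ∈-++⁺ˡ d∈us
  ... | inj₂ d∈vs = ∈-++⁺ʳ us (there d∈vs)

  All-delete : ∀ {P : A → Set} {v} (us vs : List A) → All P (us ++ v ∷ vs) → All P (us ++ vs)
  All-delete []       vs (_ ∷ ps)  = ps
  All-delete (u ∷ us) vs (p ∷ ps)  = p ∷ All-delete us vs ps

  Unique-delete : ∀ {v} (us vs : List A) → Unique (us ++ v ∷ vs) → Unique (us ++ vs)
  Unique-delete []       vs (_ ∷ u)  = u
  Unique-delete (_ ∷ us) vs (v∉ ∷ u) = All-delete us vs v∉ ∷ Unique-delete us vs u

  Unique⇒∉-delete : ∀ {v} (us vs : List A) → Unique (us ++ v ∷ vs) → v ∉ us ++ vs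
  Unique⇒∉-delete []       vs (v∉ ∷ _) v∈     = All.lookup v∉ v∈ refl
  Unique⇒∉-delete (u ∷ us) vs (u∉ ∷ _) (here v≡u) = All.lookup u∉ (∈-++⁺ʳ us (here refl)) (sym v≡u)
  Unique⇒∉-delete (_ ∷ us) vs (_ ∷ uniq) (there v∈) = Unique⇒∉-delete us vs uniq v∈

  length-delete : ∀ (us vs : List A) {v} → length (us ++ v ∷ vs) ≡ suc (length (us ++ vs))
  length-delete us vs = trans (length-++ us) (trans (ℕP.+-suc (length us) (length vs)) (cong suc (sym (length-++ us))))

  ∑-delete : ∀ (us vs : List A) {v} f → ∑ (us ++ v ∷ vs) f ≡ f v + ∑ (us ++ vs) f
  ∑-delete us vs {v} f = begin
    ∑ (us ++ v ∷ vs) f        ≡⟨ ∑-++ us (v ∷ vs) f ⟩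
    ∑ us f + (f v + ∑ vs f)   ≡⟨ solve 3 (λ a b c → a :+ (b :+ c) := b :+ (a :+ c)) refl (∑ us f) (f v) (∑ vs f) ⟩
    f v + (∑ us f + ∑ vs f)   ≡⟨ cong (f v +_) (sym (∑-++ us vs f)) ⟩
    f v + ∑ (us ++ vs) f      ∎
    where open ≡-Reasoning

  ∑-mono-⊆ : ∀ (xs ys : List A) f → Unique xs → (∀ {x} → x ∈ xs → x ∈ ys) → (∀ x → 0ℚ ≤ f x) → ∑ xs f ≤ ∑ ys f
  ∑-mono-⊆ []       ys f _          _  f≥0 = ∑-nonNeg ys f≥0
  ∑-mono-⊆ (c ∷ xs) ys f (c∉ ∷ u) xs⊆ f≥0 with ∈-∃++ (xs⊆ (here refl))
  ... | us , vs , refl = ≤-trans (+-monoʳ-≤ (f c) (∑-mono-⊆ xs (us ++ vs) f u xs⊆us++vs f≥0))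
                                 (≤-reflexive (sym (∑-delete us vs f)))
    where
    xs⊆us++vs : ∀ {d} → d ∈ xs → d ∈ us ++ vs
    xs⊆us++vs d∈ = ∈-delete us vs (xs⊆ (there d∈)) (λ d≡c → All.lookup c∉ d∈ (sym d≡c))

  length-mono-⊆ : ∀ (xs ys : List A) → Unique xs → (∀ {x} → x ∈ xs → x ∈ ys) → length xs ≤ℕ length ys
  length-mono-⊆ xs ys u xs⊆ys = ⟦⟧-cancel-≤ (begin
    ⟦ length xs ⟧          ≡⟨ sym (∑-count xs) ⟩
    ∑ xs (λ _ → 1ℚ)        ≤⟨ ∑-mono-⊆ xs ys (λ _ → 1ℚ) u xs⊆ys (λ _ → inv-nonNeg 1) ⟩
    ∑ ys (λ _ → 1ℚ)        ≡⟨ ∑-count ys ⟩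
    ⟦ length ys ⟧          ∎)
    where open ≤-Reasoning

range : ℕ → List ℕ
range n = applyUpTo suc n

∈-range⁻ : ∀ {k n} → k ∈ range n → 1 ≤ℕ k × k ≤ℕ n
∈-range⁻ k∈ with ∈-applyUpTo⁻ suc k∈
... | i , i<n , refl = ℕ.s≤s ℕ.z≤n , i<n

∈-range⁺ : ∀ {k n} → 1 ≤ℕ k → k ≤ℕ n → k ∈ range n
∈-range⁺ {suc k} _ k<n = ∈-applyUpTo⁺ suc k<n

range-unique : ∀ n → Unique (range n)
range-unique n = Unique.applyUpTo⁺₁ suc n (λ i<j _ i≡j → ℕP.<⇒≢ i<j (ℕP.suc-injective i≡j))

length-range : ∀ n → length (range n) ≡ n
length-range = length-applyUpTo suc

∑-range-suc : ∀ n f → ∑ (range (suc n)) f ≡ ∑ (range n) f + f (suc n)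
∑-range-suc n f = begin
  ∑ (range (suc n)) f              ≡⟨ cong (λ xs → ∑ xs f) (sym (applyUpTo-∷ʳ suc n)) ⟩
  ∑ (range n ++ [ suc n ]) f       ≡⟨ ∑-++ (range n) [ suc n ] f ⟩
  ∑ (range n) f + (f (suc n) + 0ℚ) ≡⟨ cong (∑ (range n) f +_) (+-identityʳ (f (suc n))) ⟩
  ∑ (range n) f + f (suc n)        ∎
  where open ≡-Reasoning

length-cartesianProduct : {A B : Set} (xs : List A) (ys : List B) →
                          length (cartesianProduct xs ys) ≡ length xs ℕ.* length ys
length-cartesianProduct []       ys = refl
length-cartesianProduct (x ∷ xs) ys = trans (length-++ (map (x ,_) ys))
  (cong₂ ℕ._+_ (length-map (x ,_) ys) (length-cartesianProduct xs ys))

rectangle : ℕ → ℕ → List Cell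
rectangle a b = cartesianProduct (range a) (range b)

∈-rectangle⁺ : ∀ {x y a b} → 1 ≤ℕ x → x ≤ℕ a → 1 ≤ℕ y → y ≤ℕ b → (x , y) ∈ rectangle a b
∈-rectangle⁺ 1≤x x≤a 1≤y y≤b = ∈-cartesianProduct⁺ (∈-range⁺ 1≤x x≤a) (∈-range⁺ 1≤y y≤b)

∈-rectangle⁻ : ∀ {x y a b} → (x , y) ∈ rectangle a b → (1 ≤ℕ x × x ≤ℕ a) × (1 ≤ℕ y × y ≤ℕ b)
∈-rectangle⁻ {a = a} {b} xy∈ with ∈-cartesianProduct⁻ (range a) (range b) xy∈
... | x∈ , y∈ = ∈-range⁻ x∈ , ∈-range⁻ y∈

rectangle-unique : ∀ a b → Unique (rectangle a b)
rectangle-unique a b = Unique.cartesianProduct⁺ (range-unique a) (range-unique b)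

length-rectangle : ∀ a b → length (rectangle a b) ≡ a ℕ.* b
length-rectangle a b = trans (length-cartesianProduct (range a) (range b)) (cong₂ ℕ._*_ (length-range a) (length-range b))

-- Harmonic numbers

H-nonNeg : ∀ n → 0ℚ ≤ H n
H-nonNeg zero    = ≤-refl
H-nonNeg (suc n) = +-mono-≤ {0ℚ} {H n} {0ℚ} (H-nonNeg n) (inv-nonNeg (suc n))

H-mono-≤ : ∀ {m n} → m ≤ℕ n → H m ≤ H n
H-mono-≤ {m} {n} m≤n with ℕP.m≤n⇒∃[o]m+o≡n m≤n
... | o , refl = H-≤-+ m o
  where
  H-≤-+ : ∀ m o → H m ≤ H (m ℕ.+ o)
  H-≤-+ m zero    rewrite ℕP.+-identityʳ m = ≤-refl
  H-≤-+ m (suc o) rewrite ℕP.+-suc m o =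
    ≤-trans (H-≤-+ m o) (≤-trans (≤-reflexive (sym (+-identityʳ _))) (+-monoʳ-≤ (H (m ℕ.+ o)) (inv-nonNeg (suc (m ℕ.+ o)))))

∑-range-inv : ∀ n → ∑ (range n) inv ≡ H n
∑-range-inv zero    = refl
∑-range-inv (suc n) = trans (∑-range-suc n inv) (cong (_+ inv (suc n)) (∑-range-inv n))

H≤⟦⟧ : ∀ n → H n ≤ ⟦ n ⟧
H≤⟦⟧ zero    = ≤-refl
H≤⟦⟧ (suc n) = ≤-trans (+-mono-≤ (H≤⟦⟧ n) (inv≤1 (suc n))) (≤-reflexive (sym (⟦⟧-suc n)))

private
  *inv-suc≤*inv : ∀ m a → ⟦ a ⟧ * inv (suc (m ℕ.+ a)) ≤ ⟦ a ⟧ * inv (m ℕ.+ a)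
  *inv-suc≤*inv m zero    = ≤-reflexive (trans (*-zeroˡ (inv (suc (m ℕ.+ 0)))) (sym (*-zeroˡ (inv (m ℕ.+ 0)))))
  *inv-suc≤*inv m (suc a) rewrite ℕP.+-suc m a = *-monoˡ-≤-0≤ ⟦ suc a ⟧ (⟦⟧-nonNeg (suc a)) (inv-antimono-≤ {m ℕ.+ a} (ℕP.n≤1+n _))

H-+-lower : ∀ m a → H m + ⟦ a ⟧ * inv (m ℕ.+ a) ≤ H (m ℕ.+ a)
H-+-lower m zero rewrite ℕP.+-identityʳ m = ≤-reflexive (trans (cong (H m +_) (*-zeroˡ (inv m))) (+-identityʳ (H m)))
H-+-lower m (suc a) rewrite ℕP.+-suc m a = begin
  H m + ⟦ suc a ⟧ * s                  ≡⟨ cong (λ z → H m + z * s) (⟦⟧-suc a) ⟩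
  H m + (⟦ a ⟧ + 1ℚ) * s               ≡⟨ solve 3 (λ h x s → h :+ (x :+ con 1ℚ) :* s := (h :+ x :* s) :+ s) refl (H m) ⟦ a ⟧ s ⟩
  (H m + ⟦ a ⟧ * s) + s                ≤⟨ +-monoˡ-≤ s (+-monoʳ-≤ (H m) (*inv-suc≤*inv m a)) ⟩
  (H m + ⟦ a ⟧ * inv (m ℕ.+ a)) + s    ≤⟨ +-monoˡ-≤ s (H-+-lower m a) ⟩
  H (m ℕ.+ a) + s                      ∎
  where
  open ≤-Reasoning
  s = inv (suc (m ℕ.+ a))

H-+-upper : ∀ m a → H (m ℕ.+ a) ≤ H m + ⟦ a ⟧ * inv (suc m)
H-+-upper m zero rewrite ℕP.+-identityʳ m = ≤-reflexive (sym (trans (cong (H m +_) (*-zeroˡ (inv (suc m)))) (+-identityʳ (H m))))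
H-+-upper m (suc a) rewrite ℕP.+-suc m a = begin
  H (m ℕ.+ a) + inv (suc (m ℕ.+ a))  ≤⟨ +-mono-≤ (H-+-upper m a) (inv-antimono-≤ (ℕ.s≤s (ℕP.m≤m+n m a))) ⟩
  (H m + ⟦ a ⟧ * s) + s              ≡⟨ solve 3 (λ h x s → (h :+ x :* s) :+ s := h :+ (x :+ con 1ℚ) :* s) refl (H m) ⟦ a ⟧ s ⟩
  H m + (⟦ a ⟧ + 1ℚ) * s             ≡⟨ cong (λ z → H m + z * s) (sym (⟦⟧-suc a)) ⟩
  H m + ⟦ suc a ⟧ * s                ∎
  where
  open ≤-Reasoning
  s = inv (suc m)

-- H (a (j + 1)) - H (a j) is a sum of a terms, each at least 1/(a (j + 1)).
H+H≤H-*+1 : ∀ a b → H (suc a) + H (suc b) ≤ H (suc a ℕ.* suc b) + 1ℚ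
H+H≤H-*+1 a zero = ≤-reflexive (cong (λ n → H n + 1ℚ) (sym (ℕP.*-identityʳ (suc a))))
H+H≤H-*+1 a (suc b) = begin
  H (suc a) + (H (suc b) + i)                     ≡⟨ sym (+-assoc (H (suc a)) (H (suc b)) i) ⟩
  (H (suc a) + H (suc b)) + i                     ≤⟨ +-monoˡ-≤ i (H+H≤H-*+1 a b) ⟩
  (H P + 1ℚ) + i                                  ≡⟨ solve 3 (λ h o i → (h :+ o) :+ i := (h :+ i) :+ o) refl (H P) 1ℚ i ⟩
  (H P + i) + 1ℚ                                  ≡⟨ cong (λ z → (H P + z) + 1ℚ) (sym (⟦⟧*inv-*-cancel a (suc (suc b)))) ⟩
  (H P + ⟦ suc a ⟧ * inv (suc a ℕ.* suc (suc b))) + 1ℚ ≡⟨ cong (λ n → (H P + ⟦ suc a ⟧ * inv n) + 1ℚ) P+a ⟩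
  (H P + ⟦ suc a ⟧ * inv (P ℕ.+ suc a)) + 1ℚ      ≤⟨ +-monoˡ-≤ 1ℚ (H-+-lower P (suc a)) ⟩
  H (P ℕ.+ suc a) + 1ℚ                            ≡⟨ cong (λ n → H n + 1ℚ) (sym P+a) ⟩
  H (suc a ℕ.* suc (suc b)) + 1ℚ                  ∎
  where
  open ≤-Reasoning
  i = inv (suc (suc b))
  P = suc a ℕ.* suc b
  P+a : suc a ℕ.* suc (suc b) ≡ P ℕ.+ suc a
  P+a = trans (ℕP.*-suc (suc a) (suc b)) (ℕP.+-comm (suc a) P)

-- H (a (j + 1)) - H (a j) is a sum of a terms, each at most 1/(a j + 1).
H-*≤H+H : ∀ a b → H (a ℕ.* suc b) ≤ H a + H b
H-*≤H+H a zero rewrite ℕP.*-identityʳ a = ≤-reflexive (sym (+-identityʳ (H a)))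
H-*≤H+H a (suc b) = begin
  H (a ℕ.* suc (suc b))                           ≡⟨ cong H P+a ⟩
  H (a ℕ.* suc b ℕ.+ a)                           ≤⟨ H-+-upper (a ℕ.* suc b) a ⟩
  H (a ℕ.* suc b) + ⟦ a ⟧ * inv (suc (a ℕ.* suc b)) ≤⟨ +-mono-≤ (H-*≤H+H a b) (block a) ⟩
  (H a + H b) + inv (suc b)                       ≡⟨ +-assoc (H a) (H b) _ ⟩
  H a + H (suc b)                                 ∎
  where
  open ≤-Reasoning
  P+a : a ℕ.* suc (suc b) ≡ a ℕ.* suc b ℕ.+ a
  P+a = trans (ℕP.*-suc a (suc b)) (ℕP.+-comm a (a ℕ.* suc b))
  block : ∀ a → ⟦ a ⟧ * inv (suc (a ℕ.* suc b)) ≤ inv (suc b)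
  block zero    = ≤-trans (≤-reflexive (*-zeroˡ (inv 1))) (inv-nonNeg (suc b))
  block (suc a) = ≤-trans (*-monoˡ-≤-0≤ ⟦ suc a ⟧ (⟦⟧-nonNeg (suc a)) (inv-antimono-≤ {b ℕ.+ a ℕ.* suc b} (ℕP.n≤1+n _)))
                          (≤-reflexive (⟦⟧*inv-*-cancel a (suc b)))

H₂ : ℕ → ℚ
H₂ n = ∑ (range n) (λ x → inv x * inv x)

∑H/x : ℕ → ℚ
∑H/x n = ∑ (range n) (λ x → inv x * H x)

H₂-nonNeg : ∀ n → 0ℚ ≤ H₂ n
H₂-nonNeg n = ∑-nonNeg (range n) (λ x → 0≤* (inv-nonNeg x) (inv-nonNeg x))

H₂≤H : ∀ n → H₂ n ≤ H n
H₂≤H n = ≤-trans (∑-mono-≤ (range n) (λ x _ → ≤-trans (*-monoʳ-≤-0≤ (inv x) (inv-nonNeg x) (inv≤1 x)) (≤-reflexive (*-identityˡ (inv x)))))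
                 (≤-reflexive (∑-range-inv n))

-- Both sides are Σ_{x , y ≤ n} 1/(x y) + Σ_{x ≤ n} 1/x².
∑H/x-double : ∀ n → ∑H/x n + ∑H/x n ≡ H n * H n + H₂ n
∑H/x-double zero    = refl
∑H/x-double (suc n) = begin
  ∑H/x (suc n) + ∑H/x (suc n)                  ≡⟨ cong₂ _+_ (∑-range-suc n _) (∑-range-suc n _) ⟩
  (A + i * (H n + i)) + (A + i * (H n + i))    ≡⟨ solve 3 (λ a i h → (a :+ i :* (h :+ i)) :+ (a :+ i :* (h :+ i))
                                                            := (a :+ a) :+ ((con 1ℚ :+ con 1ℚ) :* i :* h :+ (con 1ℚ :+ con 1ℚ) :* i :* i))
                                                      refl A i (H n) ⟩
  (A + A) + 2ih                                ≡⟨ cong (_+ 2ih) (∑H/x-double n) ⟩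
  (H n * H n + H₂ n) + 2ih                     ≡⟨ solve 3 (λ h q i → (h :* h :+ q) :+ ((con 1ℚ :+ con 1ℚ) :* i :* h :+ (con 1ℚ :+ con 1ℚ) :* i :* i)
                                                            := (h :+ i) :* (h :+ i) :+ (q :+ i :* i))
                                                      refl (H n) (H₂ n) i ⟩
  H (suc n) * H (suc n) + (H₂ n + i * i)       ≡⟨ cong (H (suc n) * H (suc n) +_) (sym (∑-range-suc n _)) ⟩
  H (suc n) * H (suc n) + H₂ (suc n)           ∎
  where
  open ≡-Reasoning
  i = inv (suc n)
  A = ∑H/x n
  2ih = (1ℚ + 1ℚ) * i * H n + (1ℚ + 1ℚ) * i * i

-- Splitting H n after its first m terms; with m ≈ √n this gives H n = O(√n).
H+1≤ : ∀ n m → H n + 1ℚ ≤ ⟦ suc m ⟧ + ⟦ n ⟧ * inv (suc m)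
H+1≤ n m with ℕP.≤-total n m
... | inj₁ n≤m = ≤-trans (+-monoˡ-≤ 1ℚ (≤-trans (H≤⟦⟧ n) (⟦⟧-mono-≤ n≤m)))
                 (≤-trans (≤-reflexive (sym (⟦⟧-suc m)))
                 (≤-trans (≤-reflexive (sym (+-identityʳ _))) (+-monoʳ-≤ ⟦ suc m ⟧ (0≤* (⟦⟧-nonNeg n) (inv-nonNeg (suc m))))))
... | inj₂ m≤n with ℕP.m≤n⇒∃[o]m+o≡n m≤n
... | a , refl = begin
  H (m ℕ.+ a) + 1ℚ                                ≤⟨ +-monoˡ-≤ 1ℚ (H-+-upper m a) ⟩
  (H m + ⟦ a ⟧ * inv (suc m)) + 1ℚ                ≤⟨ +-monoˡ-≤ 1ℚ (+-mono-≤ (H≤⟦⟧ m)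
                                                       (*-monoʳ-≤-0≤ (inv (suc m)) (inv-nonNeg (suc m)) (⟦⟧-mono-≤ (ℕP.m≤n+m a m)))) ⟩
  (⟦ m ⟧ + ⟦ m ℕ.+ a ⟧ * inv (suc m)) + 1ℚ        ≡⟨ solve 2 (λ x y → (x :+ y) :+ con 1ℚ := (x :+ con 1ℚ) :+ y) refl ⟦ m ⟧ _ ⟩
  (⟦ m ⟧ + 1ℚ) + ⟦ m ℕ.+ a ⟧ * inv (suc m)        ≡⟨ cong (_+ ⟦ m ℕ.+ a ⟧ * inv (suc m)) (sym (⟦⟧-suc m)) ⟩
  ⟦ suc m ⟧ + ⟦ m ℕ.+ a ⟧ * inv (suc m)           ∎
  where open ≤-Reasoning

-- Boards, and E as a total weight

_⊑_ : Cell → Cell → Set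

(a , b) ⊑ (p , q) = (a ≤ℕ p) × (b ≤ℕ q)

_⊑ᵇ_ : Cell → Cell → Bool

(a , b) ⊑ᵇ (p , q) = (a ≤ᵇ p) ∧ (b ≤ᵇ q)

⊑ᵇ⇒⊑ : ∀ c d → T (c ⊑ᵇ d) → c ⊑ d
⊑ᵇ⇒⊑ (a , b) (p , q) t = let (a≤p , b≤q) = Equivalence.to T-∧ t in ℕP.≤ᵇ⇒≤ a p a≤p , ℕP.≤ᵇ⇒≤ b q b≤q

⊑⇒⊑ᵇ : ∀ c d → c ⊑ d → T (c ⊑ᵇ d)
⊑⇒⊑ᵇ (a , b) (p , q) (a≤p , b≤q) = Equivalence.from T-∧ (ℕP.≤⇒≤ᵇ a≤p , ℕP.≤⇒≤ᵇ b≤q)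

⊑-refl : ∀ c → c ⊑ c
⊑-refl (a , b) = ℕP.≤-refl , ℕP.≤-refl

⊑-trans : ∀ {c d e} → c ⊑ d → d ⊑ e → c ⊑ e
⊑-trans (a≤p , b≤q) (p≤s , q≤t) = ℕP.≤-trans a≤p p≤s , ℕP.≤-trans b≤q q≤t

private
  T-not⁻ : ∀ {b} → T (not b) → ¬ T b
  T-not⁻ {true} ()

  T-not⁺ : ∀ {b} → ¬ T b → T (not b)
  T-not⁺ {false} _   = _
  T-not⁺ {true}  ¬tt = ¬tt _

∈-chomp⁻ : ∀ {c d B} → d ∈ chomp c B → d ∈ B × ¬ (c ⊑ d)
∈-chomp⁻ {c} {d} {B} d∈ with ∈-filter⁻ (T? ∘ (λ d → not (c ⊑ᵇ d))) {xs = B} d∈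
... | d∈B , t = d∈B , λ c⊑d → T-not⁻ t (⊑⇒⊑ᵇ c d c⊑d)

∈-chomp⁺ : ∀ {c d B} → d ∈ B → ¬ (c ⊑ d) → d ∈ chomp c B
∈-chomp⁺ {c} {d} d∈B c⋢d = ∈-filter⁺ (T? ∘ (λ d → not (c ⊑ᵇ d))) d∈B (T-not⁺ (c⋢d ∘ ⊑ᵇ⇒⊑ c d))

chomp-isBoard : ∀ c B → IsBoard B → IsBoard (chomp c B)
chomp-isBoard c B (unique , positive , closed) =
  Unique.filter⁺ (T? ∘ (λ d → not (c ⊑ᵇ d))) unique ,
  All.tabulate (All.lookup positive ∘ proj₁ ∘ ∈-chomp⁻ {c} {B = B}) ,
  λ x y p q xy∈ 1≤p p≤x 1≤q q≤y → let (xy∈B , c⋢xy) = ∈-chomp⁻ {c} {B = B} xy∈ in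
    ∈-chomp⁺ {c} {B = B} (closed x y p q xy∈B 1≤p p≤x 1≤q q≤y) (λ c⊑pq → c⋢xy (⊑-trans {c} c⊑pq (p≤x , q≤y)))

length-chomp< : ∀ {c B} → c ∈ B → length (chomp c B) <ℕ length B
length-chomp< {c} {B} c∈B = filter-notAll (T? ∘ (λ d → not (c ⊑ᵇ d))) B (chosen c∈B)
  where
  chosen : ∀ {B} → c ∈ B → Any (λ d → ¬ T (not (c ⊑ᵇ d))) B
  chosen (here refl) = here (λ t → T-not⁻ t (⊑⇒⊑ᵇ c c (⊑-refl c)))
  chosen (there c∈) = there (chosen c∈)

rectangle⊆board : ∀ {B x y} → IsBoard B → (x , y) ∈ B → ∀ {c} → c ∈ rectangle x y → c ∈ B
rectangle⊆board {x = x} {y} (_ , _ , closed) xy∈ {p , q} pq∈ with ∈-rectangle⁻ {p} {q} {x} {y} pq∈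
... | (1≤p , p≤x) , (1≤q , q≤y) = closed x y p q xy∈ 1≤p p≤x 1≤q q≤y

area≤length : ∀ {B x y} → IsBoard B → (x , y) ∈ B → x ℕ.* y ≤ℕ length B
area≤length {B} {x} {y} board xy∈ = subst (_≤ℕ length B) (length-rectangle x y)
  (length-mono-⊆ (rectangle x y) B (rectangle-unique x y) (rectangle⊆board board xy∈))

-- The cells of a board below (x , y) are exactly the cells of the x × y rectangle.
length-below : ∀ {B x y} → IsBoard B → (x , y) ∈ B → length (filterᵇ (_⊑ᵇ (x , y)) B) ≡ x ℕ.* y
length-below {B} {x} {y} board@(unique , positive , closed) xy∈ = trans
  (ℕP.≤-antisym (length-mono-⊆ below (rectangle x y) (Unique.filter⁺ below? unique) below⊆rectangle)
                (length-mono-⊆ (rectangle x y) below (rectangle-unique x y) rectangle⊆below))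
  (length-rectangle x y)
  where
  below? = T? ∘ (_⊑ᵇ (x , y))
  below = filterᵇ (_⊑ᵇ (x , y)) B
  below⊆rectangle : ∀ {c} → c ∈ below → c ∈ rectangle x y
  below⊆rectangle {p , q} c∈ with ∈-filter⁻ below? {xs = B} c∈
  ... | c∈B , t = let (1≤p , 1≤q) = All.lookup positive c∈B ; (p≤x , q≤y) = ⊑ᵇ⇒⊑ (p , q) (x , y) t
                  in ∈-rectangle⁺ 1≤p p≤x 1≤q q≤y
  rectangle⊆below : ∀ {c} → c ∈ rectangle x y → c ∈ below
  rectangle⊆below {p , q} c∈ with ∈-rectangle⁻ {p} {q} {x} {y} c∈
  ... | (1≤p , p≤x) , (1≤q , q≤y) = ∈-filter⁺ below? (closed x y p q xy∈ 1≤p p≤x 1≤q q≤y) (⊑⇒⊑ᵇ (p , q) (x , y) (p≤x , q≤y))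

weight : Cell → ℚ
weight (x , y) = inv (x ℕ.* y)

totalWeight : List Cell → ℚ
totalWeight B = ∑ B weight

weight-nonNeg : ∀ d → 0ℚ ≤ weight d
weight-nonNeg (x , y) = inv-nonNeg (x ℕ.* y)

totalWeight-nonNeg : ∀ B → 0ℚ ≤ totalWeight B
totalWeight-nonNeg B = ∑-nonNeg B weight-nonNeg

private
  if-not : ∀ (b : Bool) w → (if not b then w else 0ℚ) ≡ w - (if b then w else 0ℚ)
  if-not false w = sym (+-identityʳ w)
  if-not true  w = sym (+-inverseʳ w)

  if-scale : ∀ (b : Bool) w → (if b then w else 0ℚ) ≡ w * (if b then 1ℚ else 0ℚ)
  if-scale false w = sym (*-zeroʳ w)
  if-scale true  w = sym (*-identityʳ w)

-- Each cell d = (x , y) of B is removed by exactly the x y choices c ⊑ d, each time losing weight 1/(x y).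
∑-totalWeight-chomp : ∀ B → IsBoard B → ∑ B (λ c → totalWeight (chomp c B)) ≡ ⟦ length B ⟧ * totalWeight B - ⟦ length B ⟧
∑-totalWeight-chomp B board = begin
  ∑ B (λ c → totalWeight (chomp c B))                    ≡⟨ ∑-cong B (λ c _ → totalWeight-chomp c) ⟩
  ∑ B (λ c → ∑ B (λ d → weight d - removed c d))         ≡⟨ ∑-comm B B (λ c d → weight d - removed c d) ⟩
  ∑ B (λ d → ∑ B (λ c → weight d - removed c d))         ≡⟨ ∑-cong B removedTotal ⟩
  ∑ B (λ d → N * weight d - 1ℚ)                          ≡⟨ ∑-- B (λ d → N * weight d) (λ _ → 1ℚ) ⟩
  ∑ B (λ d → N * weight d) - ∑ B (λ _ → 1ℚ)              ≡⟨ cong₂ _-_ (∑-*ˡ B N weight) (∑-count B) ⟩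
  N * totalWeight B - N                                  ∎
  where
  open ≡-Reasoning
  N = ⟦ length B ⟧
  removed : Cell → Cell → ℚ
  removed c d = if c ⊑ᵇ d then weight d else 0ℚ
  totalWeight-chomp : ∀ c → totalWeight (chomp c B) ≡ ∑ B (λ d → weight d - removed c d)
  totalWeight-chomp c = trans (∑-filterᵇ (λ d → not (c ⊑ᵇ d)) B weight) (∑-cong B (λ d _ → if-not (c ⊑ᵇ d) (weight d)))
  removedTotal : ∀ d → d ∈ B → ∑ B (λ c → weight d - removed c d) ≡ N * weight d - 1ℚ
  removedTotal (suc x , suc y) d∈ = begin
    ∑ B (λ c → weight d - removed c d)                          ≡⟨ ∑-- B (λ _ → weight d) (λ c → removed c d) ⟩
    ∑ B (λ _ → weight d) - ∑ B (λ c → removed c d)              ≡⟨ cong₂ _-_ (∑-const B (weight d)) (∑-cong B (λ c _ → if-scale (c ⊑ᵇ d) (weight d))) ⟩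
    N * weight d - ∑ B (λ c → weight d * below c)               ≡⟨ cong (λ z → N * weight d - z) (∑-*ˡ B (weight d) below) ⟩
    N * weight d - weight d * ∑ B below                         ≡⟨ cong (λ z → N * weight d - weight d * z) countBelow ⟩
    N * weight d - weight d * ⟦ suc x ℕ.* suc y ⟧                ≡⟨ cong (λ z → N * weight d - z) (inv-inverseˡ (y ℕ.+ x ℕ.* suc y)) ⟩
    N * weight d - 1ℚ                                           ∎
    where
    d = (suc x , suc y)
    below : Cell → ℚ
    below c = if c ⊑ᵇ d then 1ℚ else 0ℚ
    countBelow : ∑ B below ≡ ⟦ suc x ℕ.* suc y ⟧
    countBelow = trans (sym (∑-filterᵇ (_⊑ᵇ d) B (λ _ → 1ℚ)))
                       (trans (∑-count (filterᵇ (_⊑ᵇ d) B)) (cong ⟦_⟧ (length-below board d∈)))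
  removedTotal (zero , _) d∈ with () ← All.lookup (proj₁ (proj₂ board)) d∈
  removedTotal (suc _ , zero) d∈ with () ← All.lookup (proj₁ (proj₂ board)) d∈

sumE≡∑ : ∀ f B xs → sumE f B xs ≡ ∑ xs (λ c → Efuel f (chomp c B))
sumE≡∑ f B []       = refl
sumE≡∑ f B (c ∷ xs) = cong (Efuel f (chomp c B) +_) (sumE≡∑ f B xs)

-- totalWeight satisfies the recursion defining E: W B = 1 + (1/N) Σ_{c ∈ B} W (chomp c B).
Efuel≡totalWeight : ∀ f B → IsBoard B → length B ≤ℕ f → Efuel f B ≡ totalWeight B
Efuel≡totalWeight zero    []            _     _   = refl
Efuel≡totalWeight (suc f) []            _     _   = refl
Efuel≡totalWeight (suc f) B@(c₀ ∷ cs) board B≤f = begin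
  1ℚ + r * sumE f B B                                 ≡⟨ cong (λ z → 1ℚ + r * z) (trans (sumE≡∑ f B B) (∑-cong B ih)) ⟩
  1ℚ + r * ∑ B (λ c → totalWeight (chomp c B))        ≡⟨ cong (λ z → 1ℚ + r * z) (∑-totalWeight-chomp B board) ⟩
  1ℚ + r * (n * W - n)                                ≡⟨ solve 3 (λ r n w → con 1ℚ :+ r :* (n :* w :- n) := w :+ (con 1ℚ :- r :* n) :* (con 1ℚ :- w)) refl r n W ⟩
  W + (1ℚ - r * n) * (1ℚ - W)                         ≡⟨ cong (λ z → W + (1ℚ - z) * (1ℚ - W)) (inv-inverseˡ (length cs)) ⟩
  W + 0ℚ * (1ℚ - W)                                   ≡⟨ cong (W +_) (*-zeroˡ (1ℚ - W)) ⟩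
  W + 0ℚ                                              ≡⟨ +-identityʳ W ⟩
  W                                                   ∎
  where
  open ≡-Reasoning
  r = inv (length B)
  n = ⟦ length B ⟧
  W = totalWeight B
  ih : ∀ c → c ∈ B → Efuel f (chomp c B) ≡ totalWeight (chomp c B)
  ih c c∈ = Efuel≡totalWeight f (chomp c B) (chomp-isBoard c B board) (ℕP.≤-pred (ℕP.≤-trans (length-chomp< {c} {B} c∈) B≤f))

E≡totalWeight : ∀ B → IsBoard B → E B ≡ totalWeight B
E≡totalWeight B board = Efuel≡totalWeight (length B) B board ℕP.≤-refl

-- The lower bound

level : Cell → ℕ
level (x , y) = x ℕ.+ y

maximal-level : ∀ B → 1 ≤ℕ length B → ∃ λ m → m ∈ B × (∀ d → d ∈ B → level d ≤ℕ level m)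
maximal-level (c ∷ cs) _ = argmax level c cs , m∈ , maximal
  where
  m∈ : argmax level c cs ∈ c ∷ cs
  m∈ with argmax-sel level c cs
  ... | inj₁ m≡c  = here m≡c
  ... | inj₂ m∈cs = there m∈cs
  maximal : ∀ d → d ∈ c ∷ cs → level d ≤ℕ level (argmax level c cs)
  maximal d (here refl)  = f[⊥]≤f[argmax] {f = level} c cs
  maximal d (there d∈cs) = All.lookup (f[xs]≤f[argmax] {f = level} c cs) d∈cs

⊑∧level≤⇒≡ : ∀ {m d} → m ⊑ d → level d ≤ℕ level m → d ≡ m
⊑∧level≤⇒≡ {m₁ , m₂} {d₁ , d₂} (m₁≤d₁ , m₂≤d₂) d≤m = cong₂ _,_ (ℕP.≤-antisym d₁≤m₁ m₁≤d₁) (ℕP.≤-antisym d₂≤m₂ m₂≤d₂)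
  where
  d₁≤m₁ : d₁ ≤ℕ m₁
  d₁≤m₁ = ℕP.+-cancelʳ-≤ d₂ d₁ m₁ (ℕP.≤-trans d≤m (ℕP.+-monoʳ-≤ m₁ m₂≤d₂))
  d₂≤m₂ : d₂ ≤ℕ m₂
  d₂≤m₂ = ℕP.+-cancelˡ-≤ d₁ d₂ m₂ (ℕP.≤-trans d≤m (ℕP.+-monoˡ-≤ m₂ m₁≤d₁))

-- A cell of maximal level is a corner: nothing lies strictly above-right of it.
delete-maximal-isBoard : ∀ us m vs → IsBoard (us ++ m ∷ vs) → (∀ d → d ∈ us ++ m ∷ vs → level d ≤ℕ level m) →
                         IsBoard (us ++ vs)
delete-maximal-isBoard us m vs (unique , positive , closed) maximal =
  Unique-delete us vs unique , All-delete us vs positive , closed′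
  where
  closed′ : ∀ x y p q → (x , y) ∈ us ++ vs → 1 ≤ℕ p → p ≤ℕ x → 1 ≤ℕ q → q ≤ℕ y → (p , q) ∈ us ++ vs
  closed′ x y p q xy∈ 1≤p p≤x 1≤q q≤y = ∈-delete us vs (closed x y p q xy∈′ 1≤p p≤x 1≤q q≤y) pq≢m
    where
    xy∈′ = ∈-insert us vs xy∈
    pq≢m : (p , q) ≢ m
    pq≢m refl = Unique⇒∉-delete us vs unique (subst (_∈ us ++ vs) (⊑∧level≤⇒≡ (p≤x , q≤y) (maximal (x , y) xy∈′)) xy∈)

inv-length≤weight : ∀ {B d} → IsBoard B → d ∈ B → inv (length B) ≤ weight d
inv-length≤weight {B} {suc x , suc y} board d∈ = inv-antimono-≤′ (ℕ.s≤s ℕ.z≤n) (area≤length board d∈)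
inv-length≤weight {B} {zero , _} board d∈ with () ← All.lookup (proj₁ (proj₂ board)) d∈
inv-length≤weight {B} {suc _ , zero} board d∈ with () ← All.lookup (proj₁ (proj₂ board)) d∈

-- Peel off a corner cell (x , y); it has weight 1/(x y) ≥ 1/N.
H≤totalWeight : ∀ n B → IsBoard B → length B ≡ n → H n ≤ totalWeight B
H≤totalWeight zero    B board _   = totalWeight-nonNeg B
H≤totalWeight (suc n) B board len with maximal-level B (ℕP.≤-trans (ℕ.s≤s ℕ.z≤n) (ℕP.≤-reflexive (sym len)))
... | m , m∈ , maximal with ∈-∃++ m∈
... | us , vs , refl = begin
  H n + inv (suc n)                ≤⟨ +-mono-≤ (H≤totalWeight n (us ++ vs) (delete-maximal-isBoard us m vs board maximal) len′)
                                               (subst (λ k → inv k ≤ weight m) len (inv-length≤weight board m∈)) ⟩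
  totalWeight (us ++ vs) + weight m ≡⟨ +-comm _ (weight m) ⟩
  weight m + totalWeight (us ++ vs) ≡⟨ sym (∑-delete us vs weight) ⟩
  totalWeight (us ++ m ∷ vs)        ∎
  where
  open ≤-Reasoning
  len′ : length (us ++ vs) ≡ n
  len′ = ℕP.suc-injective (trans (sym (length-delete us vs)) len)

rowCell : ℕ → Cell
rowCell y = 1 , y

row : ℕ → List Cell
row n = map rowCell (range n)

row-isBoard : ∀ n → IsBoard (row n)
row-isBoard n = Unique.map⁺ (cong proj₂) (range-unique n) , All.tabulate cell-positive , closed
  where
  cell-positive : ∀ {c} → c ∈ row n → Positive c
  cell-positive c∈ with ∈-map⁻ rowCell c∈
  ... | y , y∈ , refl = ℕP.≤-refl , proj₁ (∈-range⁻ y∈)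
  closed : ∀ x y p q → (x , y) ∈ row n → 1 ≤ℕ p → p ≤ℕ x → 1 ≤ℕ q → q ≤ℕ y → (p , q) ∈ row n
  closed x y (suc zero) q xy∈ _ _ 1≤q q≤y with ∈-map⁻ rowCell xy∈
  ... | y , y∈ , refl = ∈-map⁺ rowCell (∈-range⁺ 1≤q (ℕP.≤-trans q≤y (proj₂ (∈-range⁻ y∈))))
  closed x y (suc (suc p)) q xy∈ _ p≤x _ _ with ∈-map⁻ rowCell xy∈
  ... | y , y∈ , refl with ℕ.s≤s () ← p≤x

length-row : ∀ n → length (row n) ≡ n
length-row n = trans (length-map rowCell (range n)) (length-range n)

totalWeight-row : ∀ n → totalWeight (row n) ≡ H n
totalWeight-row n = trans (∑-map rowCell (range n) weight)
                          (trans (∑-cong (range n) (λ y _ → cong inv (ℕP.*-identityˡ y))) (∑-range-inv n))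

-- Hyperbolas

-- The largest y with x y ≤ K (with the junk value 0 at x = 0).
column : ℕ → ℕ → ℕ
column K zero    = 0
column K (suc x) = K ℕ./ suc x

column≤ : ∀ K x → column K x ≤ℕ K
column≤ K zero    = ℕ.z≤n
column≤ K (suc x) = m/n≤m K (suc x)

*≤⇒≤column : ∀ K x y → suc x ℕ.* y ≤ℕ K → y ≤ℕ column K (suc x)
*≤⇒≤column K x y xy≤K = subst (_≤ℕ K ℕ./ suc x) (m*n/n≡m y (suc x))
  (/-monoˡ-≤ (suc x) (subst (_≤ℕ K) (ℕP.*-comm (suc x) y) xy≤K))

≤column⇒*≤ : ∀ K x y → y ≤ℕ column K (suc x) → suc x ℕ.* y ≤ℕ K
≤column⇒*≤ K x y y≤ = ℕP.≤-trans (ℕP.≤-trans (ℕP.≤-reflexive (ℕP.*-comm (suc x) y)) (ℕP.*-monoˡ-≤ (suc x) y≤))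
                                 (m/n*n≤m K (suc x))

≤*suc-column : ∀ K x → K ≤ℕ suc x ℕ.* suc (column K (suc x))
≤*suc-column K x = ℕP.≤-trans (ℕP.≤-reflexive (m≡m%n+[m/n]*n K (suc x)))
  (ℕP.≤-trans (ℕP.+-monoˡ-≤ _ (ℕP.<⇒≤ (m%n<n K (suc x)))) (ℕP.≤-reflexive (ℕP.*-comm (suc (K ℕ./ suc x)) (suc x))))

under-hyperbola : ℕ → Cell → Bool
under-hyperbola K (x , y) = x ℕ.* y ≤ᵇ K

hyperbola : ℕ → List Cell
hyperbola K = filterᵇ (under-hyperbola K) (rectangle K K)

∈-hyperbola⁻ : ∀ {K x y} → (x , y) ∈ hyperbola K → (1 ≤ℕ x × 1 ≤ℕ y) × x ℕ.* y ≤ℕ K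
∈-hyperbola⁻ {K} {x} {y} xy∈ with ∈-filter⁻ (T? ∘ under-hyperbola K) {xs = rectangle K K} xy∈
... | xy∈rect , t with ∈-rectangle⁻ {x} {y} {K} {K} xy∈rect
... | (1≤x , _) , (1≤y , _) = (1≤x , 1≤y) , ℕP.≤ᵇ⇒≤ (x ℕ.* y) K t

∈-hyperbola⁺ : ∀ {K x y} → 1 ≤ℕ x → 1 ≤ℕ y → x ℕ.* y ≤ℕ K → (x , y) ∈ hyperbola K
∈-hyperbola⁺ {K} {x} {y} 1≤x 1≤y xy≤K = ∈-filter⁺ (T? ∘ under-hyperbola K)
  (∈-rectangle⁺ 1≤x (ℕP.≤-trans (ℕP.m≤m*n x y {{ℕ.>-nonZero 1≤y}}) xy≤K) 1≤y (ℕP.≤-trans (ℕP.m≤n*m y x {{ℕ.>-nonZero 1≤x}}) xy≤K))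
  (ℕP.≤⇒≤ᵇ xy≤K)

hyperbola-unique : ∀ K → Unique (hyperbola K)
hyperbola-unique K = Unique.filter⁺ (T? ∘ under-hyperbola K) (rectangle-unique K K)

board⊆hyperbola : ∀ {B} → IsBoard B → ∀ {d} → d ∈ B → d ∈ hyperbola (length B)
board⊆hyperbola board@(_ , positive , _) d∈ = let (1≤x , 1≤y) = All.lookup positive d∈ in ∈-hyperbola⁺ 1≤x 1≤y (area≤length board d∈)

private
  if-true : ∀ {b : Bool} {u v : ℚ} → T b → (if b then u else v) ≡ u
  if-true {true} _ = refl

  if-false : ∀ {b : Bool} {u v : ℚ} → ¬ T b → (if b then u else v) ≡ v
  if-false {false} _  = refl
  if-false {true}  ¬t with () ← ¬t _

∑-range-if-≤ᵇ : ∀ h n (g : ℕ → ℚ) → h ≤ℕ n → ∑ (range n) (λ y → if y ≤ᵇ h then g y else 0ℚ) ≡ ∑ (range h) g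
∑-range-if-≤ᵇ zero zero g _ = refl
∑-range-if-≤ᵇ h (suc n) g h≤1+n with h ℕP.≟ suc n
... | yes refl = ∑-cong (range (suc n)) {g = g} (λ y y∈ → if-true (ℕP.≤⇒≤ᵇ (proj₂ (∈-range⁻ y∈))))
... | no h≢1+n = begin
  ∑ (range (suc n)) f            ≡⟨ ∑-range-suc n f ⟩
  ∑ (range n) f + f (suc n)      ≡⟨ cong₂ _+_ (∑-range-if-≤ᵇ h n g h≤n) (if-false (λ t → ℕP.<⇒≱ (ℕ.s≤s h≤n) (ℕP.≤ᵇ⇒≤ (suc n) h t))) ⟩
  ∑ (range h) g + 0ℚ             ≡⟨ +-identityʳ _ ⟩
  ∑ (range h) g                  ∎
  where
  open ≡-Reasoning
  f = λ y → if y ≤ᵇ h then g y else 0ℚ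
  h≤n = ℕP.≤-pred (ℕP.≤∧≢⇒< h≤1+n h≢1+n)

∑-hyperbola : ∀ K (g : Cell → ℚ) → ∑ (hyperbola K) g ≡ ∑ (range K) (λ x → ∑ (range (column K x)) (λ y → g (x , y)))
∑-hyperbola K g = begin
  ∑ (hyperbola K) g                                                            ≡⟨ ∑-filterᵇ (under-hyperbola K) (rectangle K K) g ⟩
  ∑ (rectangle K K) (λ c → if under-hyperbola K c then g c else 0ℚ)            ≡⟨ ∑-cartesianProduct (range K) (range K) _ ⟩
  ∑ (range K) (λ x → ∑ (range K) (λ y → if x ℕ.* y ≤ᵇ K then g (x , y) else 0ℚ)) ≡⟨ ∑-cong (range K) columnSum ⟩
  ∑ (range K) (λ x → ∑ (range (column K x)) (λ y → g (x , y)))                   ∎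
  where
  open ≡-Reasoning
  columnSum : ∀ x → x ∈ range K → ∑ (range K) (λ y → if x ℕ.* y ≤ᵇ K then g (x , y) else 0ℚ) ≡ ∑ (range (column K x)) (λ y → g (x , y))
  columnSum (suc x) _ = trans (∑-cong (range K) (λ y _ → cong (λ b → if b then g (suc x , y) else 0ℚ) (same y)))
                              (∑-range-if-≤ᵇ (column K (suc x)) K (λ y → g (suc x , y)) (column≤ K (suc x)))
    where
    same : ∀ y → (suc x ℕ.* y ≤ᵇ K) ≡ (y ≤ᵇ column K (suc x))
    same y with suc x ℕ.* y ≤ᵇ K in xy≤K | y ≤ᵇ column K (suc x) in y≤
    ... | true  | true  = refl
    ... | false | false = refl
    ... | true  | false with () ← subst T y≤ (ℕP.≤⇒≤ᵇ (*≤⇒≤column K x y (ℕP.≤ᵇ⇒≤ _ K (subst T (sym xy≤K) _))))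
    ... | false | true  with () ← subst T xy≤K (ℕP.≤⇒≤ᵇ (≤column⇒*≤ K x y (ℕP.≤ᵇ⇒≤ y _ (subst T (sym y≤) _))))
  columnSum zero 0∈ with () ← proj₁ (∈-range⁻ {n = K} 0∈)

totalWeight-hyperbola : ∀ K → totalWeight (hyperbola K) ≡ ∑ (range K) (λ x → inv x * H (column K x))
totalWeight-hyperbola K = trans (∑-hyperbola K weight) (∑-cong (range K) (λ x _ → begin
  ∑ (range (column K x)) (λ y → inv (x ℕ.* y))     ≡⟨ ∑-cong (range (column K x)) (λ y _ → inv-* x y) ⟩
  ∑ (range (column K x)) (λ y → inv x * inv y)     ≡⟨ ∑-*ˡ (range (column K x)) (inv x) inv ⟩
  inv x * ∑ (range (column K x)) inv               ≡⟨ cong (inv x *_) (∑-range-inv (column K x)) ⟩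
  inv x * H (column K x)                           ∎))
  where open ≡-Reasoning

H-column-lower : ∀ K x → x ∈ range K → H K - H x ≤ H (column K x)
H-column-lower K (suc x) _ = ≤+⇒-≤ (≤-trans (H-mono-≤ (≤*suc-column K x)) (H-*≤H+H (suc x) (column K (suc x))))
H-column-lower K zero 0∈ with () ← proj₁ (∈-range⁻ {n = K} 0∈)

H-column-upper : ∀ K x → x ∈ range K → H (column K x) ≤ (H K + 1ℚ) - H x
H-column-upper K (suc x) x∈ = +≤⇒≤- (bound (column K (suc x)) refl)
  where
  bound : ∀ h → h ≡ column K (suc x) → H (suc x) + H h ≤ H K + 1ℚ
  bound zero    _ = ≤-trans (≤-reflexive (+-identityʳ (H (suc x))))
                     (≤-trans (H-mono-≤ (proj₂ (∈-range⁻ x∈))) (≤-trans (≤-reflexive (sym (+-identityʳ (H K)))) (+-monoʳ-≤ (H K) (inv-nonNeg 1))))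
  bound (suc h) h≡ = ≤-trans (H+H≤H-*+1 x h) (+-monoˡ-≤ 1ℚ (H-mono-≤ (≤column⇒*≤ K x (suc h) (ℕP.≤-reflexive h≡))))
H-column-upper K zero 0∈ with () ← proj₁ (∈-range⁻ {n = K} 0∈)

∑H/x-half : ∀ K → ∑H/x K ≡ ½ * (H K * H K + H₂ K)
∑H/x-half K = trans (solve 1 (λ a → a := con ½ :* (a :+ a)) refl (∑H/x K)) (cong (½ *_) (∑H/x-double K))

∑-inv*[c-H] : ∀ K c → ∑ (range K) (λ x → inv x * (c - H x)) ≡ c * H K - ½ * (H K * H K + H₂ K)
∑-inv*[c-H] K c = begin
  ∑ (range K) (λ x → inv x * (c - H x))                        ≡⟨ ∑-cong (range K) (λ x _ → solve 3 (λ i c h → i :* (c :- h) := c :* i :- i :* h) refl (inv x) c (H x)) ⟩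
  ∑ (range K) (λ x → c * inv x - inv x * H x)                  ≡⟨ ∑-- (range K) (λ x → c * inv x) (λ x → inv x * H x) ⟩
  ∑ (range K) (λ x → c * inv x) - ∑H/x K                       ≡⟨ cong₂ _-_ (trans (∑-*ˡ (range K) c inv) (cong (c *_) (∑-range-inv K))) (∑H/x-half K) ⟩
  c * H K - ½ * (H K * H K + H₂ K)                             ∎
  where open ≡-Reasoning

totalWeight-hyperbola-upper : ∀ K → totalWeight (hyperbola K) ≤ ½ * (H K * H K) + H K
totalWeight-hyperbola-upper K = begin
  totalWeight (hyperbola K)                                    ≡⟨ totalWeight-hyperbola K ⟩
  ∑ (range K) (λ x → inv x * H (column K x))                   ≤⟨ ∑-mono-≤ (range K) (λ x x∈ → *-monoˡ-≤-0≤ (inv x) (inv-nonNeg x) (H-column-upper K x x∈)) ⟩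
  ∑ (range K) (λ x → inv x * ((H K + 1ℚ) - H x))               ≡⟨ ∑-inv*[c-H] K (H K + 1ℚ) ⟩
  (H K + 1ℚ) * H K - ½ * (H K * H K + H₂ K)                    ≡⟨ solve 2 (λ h q → (h :+ con 1ℚ) :* h :- con ½ :* (h :* h :+ q) := (con ½ :* (h :* h) :+ h) :- con ½ :* q) refl (H K) (H₂ K) ⟩
  (½ * (H K * H K) + H K) - ½ * H₂ K                           ≤⟨ +-monoʳ-≤ (½ * (H K * H K) + H K) (neg-antimono-≤ (0≤* 0≤½ (H₂-nonNeg K))) ⟩
  (½ * (H K * H K) + H K) - 0ℚ                                 ≡⟨ +-identityʳ _ ⟩
  ½ * (H K * H K) + H K                                        ∎
  where open ≤-Reasoning

totalWeight-hyperbola-lower : ∀ K → ½ * (H K * H K) - ½ * H K ≤ totalWeight (hyperbola K)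
totalWeight-hyperbola-lower K = begin
  ½ * (H K * H K) - ½ * H K                                    ≤⟨ +-monoʳ-≤ (½ * (H K * H K)) (neg-antimono-≤ (*-monoˡ-≤-0≤ ½ 0≤½ (H₂≤H K))) ⟩
  ½ * (H K * H K) - ½ * H₂ K                                   ≡⟨ solve 2 (λ h q → con ½ :* (h :* h) :- con ½ :* q := h :* h :- con ½ :* (h :* h :+ q)) refl (H K) (H₂ K) ⟩
  H K * H K - ½ * (H K * H K + H₂ K)                           ≡⟨ sym (∑-inv*[c-H] K (H K)) ⟩
  ∑ (range K) (λ x → inv x * (H K - H x))                      ≤⟨ ∑-mono-≤ (range K) (λ x x∈ → *-monoˡ-≤-0≤ (inv x) (inv-nonNeg x) (H-column-lower K x x∈)) ⟩
  ∑ (range K) (λ x → inv x * H (column K x))                   ≡⟨ sym (totalWeight-hyperbola K) ⟩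
  totalWeight (hyperbola K)                                    ∎
  where open ≤-Reasoning

length-hyperbola≤ : ∀ K → ⟦ length (hyperbola K) ⟧ ≤ ⟦ K ⟧ * H K
length-hyperbola≤ K = begin
  ⟦ length (hyperbola K) ⟧                          ≡⟨ sym (∑-count (hyperbola K)) ⟩
  ∑ (hyperbola K) (λ _ → 1ℚ)                        ≡⟨ ∑-hyperbola K (λ _ → 1ℚ) ⟩
  ∑ (range K) (λ x → ∑ (range (column K x)) (λ _ → 1ℚ)) ≡⟨ ∑-cong (range K) (λ x _ → trans (∑-count (range (column K x))) (cong ⟦_⟧ (length-range (column K x)))) ⟩
  ∑ (range K) (λ x → ⟦ column K x ⟧)                ≤⟨ ∑-mono-≤ (range K) columnLength ⟩
  ∑ (range K) (λ x → ⟦ K ⟧ * inv x)                 ≡⟨ trans (∑-*ˡ (range K) ⟦ K ⟧ inv) (cong (⟦ K ⟧ *_) (∑-range-inv K)) ⟩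
  ⟦ K ⟧ * H K                                       ∎
  where
  open ≤-Reasoning
  columnLength : ∀ x → x ∈ range K → ⟦ column K x ⟧ ≤ ⟦ K ⟧ * inv x
  columnLength (suc x) _ = begin
    ⟦ h ⟧                                ≡⟨ sym (trans (cong (⟦ h ⟧ *_) (inv-inverseʳ x)) (*-identityʳ _)) ⟩
    ⟦ h ⟧ * (⟦ suc x ⟧ * inv (suc x))    ≡⟨ sym (*-assoc ⟦ h ⟧ ⟦ suc x ⟧ _) ⟩
    (⟦ h ⟧ * ⟦ suc x ⟧) * inv (suc x)    ≡⟨ cong (_* inv (suc x)) (sym (⟦⟧-* h (suc x))) ⟩
    ⟦ h ℕ.* suc x ⟧ * inv (suc x)        ≤⟨ *-monoʳ-≤-0≤ (inv (suc x)) (inv-nonNeg (suc x)) (⟦⟧-mono-≤ (m/n*n≤m K (suc x))) ⟩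
    ⟦ K ⟧ * inv (suc x)                  ∎
    where h = column K (suc x)
  columnLength zero 0∈ with () ← proj₁ (∈-range⁻ {n = K} 0∈)

-- A board with N cells lies inside the hyperbola {x y ≤ N}.
totalWeight-upper : ∀ B → IsBoard B → totalWeight B ≤ ½ * (H (length B) * H (length B)) + H (length B)
totalWeight-upper B board = ≤-trans (∑-mono-⊆ B (hyperbola (length B)) weight (proj₁ board) (board⊆hyperbola board) weight-nonNeg)
                                    (totalWeight-hyperbola-upper (length B))

-- The scale ℓ N ≈ log₂ N

ilog₂ : ℕ → ℕ
ilog₂ zero    = 0
ilog₂ (suc n) = if 2 ^ suc (ilog₂ n) ≤ᵇ suc n then suc (ilog₂ n) else ilog₂ n

ilog₂-bounds : ∀ n → 2 ^ ilog₂ (suc n) ≤ℕ suc n × suc n <ℕ 2 ^ suc (ilog₂ (suc n))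
ilog₂-bounds zero = ℕP.≤-refl , ℕ.s≤s (ℕ.s≤s ℕ.z≤n)
ilog₂-bounds (suc n) with ilog₂-bounds n
... | lower , upper with 2 ^ suc (ilog₂ (suc n)) ≤ᵇ suc (suc n) in eq
... | true  = ℕP.≤ᵇ⇒≤ _ _ (subst T (sym eq) _) , ℕP.≤-trans (ℕ.s≤s upper) (double (2 ^ suc (ilog₂ (suc n))) (ℕP.m^n>0 2 (suc (ilog₂ (suc n)))))
  where
  double : ∀ m → 1 ≤ℕ m → suc m ≤ℕ 2 ℕ.* m
  double (suc m) _ = ℕ.s≤s (ℕP.≤-trans (ℕP.≤-reflexive (cong suc (sym (ℕP.+-identityʳ m)))) (ℕP.m≤n+m (suc (m ℕ.+ 0)) m))
... | false = ℕP.m≤n⇒m≤1+n lower , ℕP.≰⇒> (λ le → subst T eq (ℕP.≤⇒≤ᵇ le))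

2^≤⇒≤ilog₂ : ∀ j N → 2 ^ j ≤ℕ N → j ≤ℕ ilog₂ N
2^≤⇒≤ilog₂ j zero 2^j≤0 with () ← ℕP.≤-trans (ℕP.m^n>0 2 j) 2^j≤0
2^≤⇒≤ilog₂ j (suc n) 2^j≤N with j ℕP.≤? ilog₂ (suc n)
... | yes j≤ = j≤
... | no j≰ with () ← ℕP.<-irrefl refl (ℕP.<-≤-trans (proj₂ (ilog₂-bounds n)) (ℕP.≤-trans (ℕP.^-monoʳ-≤ 2 (ℕP.≰⇒> j≰)) 2^j≤N))

private
  2^suc : ∀ k → 2 ^ suc k ≡ 2 ^ k ℕ.+ 2 ^ k
  2^suc k = cong (2 ^ k ℕ.+_) (ℕP.+-identityʳ (2 ^ k))

  ⟦⟧*inv-+-self : ∀ n → 1 ≤ℕ n → ⟦ n ⟧ * inv (n ℕ.+ n) ≡ ½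
  ⟦⟧*inv-+-self (suc a) _ = trans (cong (λ z → ⟦ suc a ⟧ * inv z) (trans (cong (suc a ℕ.+_) (sym (ℕP.+-identityʳ (suc a)))) (ℕP.*-comm 2 (suc a))))
                                  (⟦⟧*inv-*-cancel a 2)

H-2^-lower : ∀ k → ⟦ k ⟧ * ½ + 1ℚ ≤ H (2 ^ k)
H-2^-lower zero    = ≤-refl
H-2^-lower (suc k) = begin
  ⟦ suc k ⟧ * ½ + 1ℚ                          ≡⟨ cong (λ z → z * ½ + 1ℚ) (⟦⟧-suc k) ⟩
  (⟦ k ⟧ + 1ℚ) * ½ + 1ℚ                       ≡⟨ solve 1 (λ x → (x :+ con 1ℚ) :* con ½ :+ con 1ℚ := (x :* con ½ :+ con 1ℚ) :+ con ½) refl ⟦ k ⟧ ⟩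
  (⟦ k ⟧ * ½ + 1ℚ) + ½                        ≤⟨ +-monoˡ-≤ ½ (H-2^-lower k) ⟩
  H (2 ^ k) + ½                               ≡⟨ cong (H (2 ^ k) +_) (sym (⟦⟧*inv-+-self (2 ^ k) (ℕP.m^n>0 2 k))) ⟩
  H (2 ^ k) + ⟦ 2 ^ k ⟧ * inv (2 ^ k ℕ.+ 2 ^ k) ≤⟨ H-+-lower (2 ^ k) (2 ^ k) ⟩
  H (2 ^ k ℕ.+ 2 ^ k)                         ≡⟨ cong H (sym (2^suc k)) ⟩
  H (2 ^ suc k)                               ∎
  where open ≤-Reasoning

H-2^-upper : ∀ k → H (2 ^ k) ≤ ⟦ k ⟧ + 1ℚ
H-2^-upper zero    = ≤-refl
H-2^-upper (suc k) = begin
  H (2 ^ suc k)                               ≡⟨ cong H (2^suc k) ⟩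
  H (2 ^ k ℕ.+ 2 ^ k)                         ≤⟨ H-+-upper (2 ^ k) (2 ^ k) ⟩
  H (2 ^ k) + ⟦ 2 ^ k ⟧ * inv (suc (2 ^ k))   ≤⟨ +-mono-≤ (H-2^-upper k) (n*inv-suc≤1 (2 ^ k)) ⟩
  (⟦ k ⟧ + 1ℚ) + 1ℚ                           ≡⟨ cong (_+ 1ℚ) (sym (⟦⟧-suc k)) ⟩
  ⟦ suc k ⟧ + 1ℚ                              ∎
  where
  open ≤-Reasoning
  n*inv-suc≤1 : ∀ n → ⟦ n ⟧ * inv (suc n) ≤ 1ℚ
  n*inv-suc≤1 n = ≤-trans (*-monoʳ-≤-0≤ (inv (suc n)) (inv-nonNeg (suc n)) (⟦⟧-mono-≤ (ℕP.n≤1+n n)))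
                          (≤-reflexive (inv-inverseʳ n))

-- ℓ N = ⌊log₂ N⌋ + 2 is comparable to H N, while H (ℓ N) / ℓ N → 0.
ℓ : ℕ → ℕ
ℓ N = suc (suc (ilog₂ N))

H≤ℓ : ∀ N → H N ≤ ⟦ ℓ N ⟧
H≤ℓ zero    = ⟦⟧-nonNeg (ℓ 0)
H≤ℓ (suc n) = begin
  H (suc n)                     ≤⟨ H-mono-≤ (ℕP.<⇒≤ (proj₂ (ilog₂-bounds n))) ⟩
  H (2 ^ suc b)                 ≤⟨ H-2^-upper (suc b) ⟩
  ⟦ suc b ⟧ + 1ℚ                ≡⟨ sym (⟦⟧-suc (suc b)) ⟩
  ⟦ ℓ (suc n) ⟧                 ∎
  where
  open ≤-Reasoning
  b = ilog₂ (suc n)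

½ℓ≤H : ∀ n → ½ * ⟦ ℓ (suc n) ⟧ ≤ H (suc n)
½ℓ≤H n = begin
  ½ * ⟦ suc (suc b) ⟧           ≡⟨ cong (½ *_) (trans (⟦⟧-suc (suc b)) (cong (_+ 1ℚ) (⟦⟧-suc b))) ⟩
  ½ * ((⟦ b ⟧ + 1ℚ) + 1ℚ)       ≡⟨ solve 1 (λ x → con ½ :* ((x :+ con 1ℚ) :+ con 1ℚ) := x :* con ½ :+ con 1ℚ) refl ⟦ b ⟧ ⟩
  ⟦ b ⟧ * ½ + 1ℚ                ≤⟨ H-2^-lower b ⟩
  H (2 ^ b)                     ≤⟨ H-mono-≤ (proj₁ (ilog₂-bounds n)) ⟩
  H (suc n)                     ∎
  where
  open ≤-Reasoning
  b = ilog₂ (suc n)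

-- Boards attaining the upper bound

tailCell : ℕ → ℕ → Cell
tailCell K j = 1 , K ℕ.+ j

hyperbolaWithTail : ℕ → ℕ → List Cell
hyperbolaWithTail K t = hyperbola K ++ map (tailCell K) (range t)

∈-tail⁻ : ∀ {K t x y} → (x , y) ∈ map (tailCell K) (range t) → x ≡ 1 × ∃ λ j → y ≡ K ℕ.+ j × 1 ≤ℕ j × j ≤ℕ t
∈-tail⁻ {K} xy∈ with ∈-map⁻ (tailCell K) xy∈
... | j , j∈ , refl = refl , j , refl , ∈-range⁻ j∈

y≤K : ∀ {K x y} → (x , y) ∈ hyperbola K → y ≤ℕ K
y≤K {K} {x} {y} xy∈ with ∈-hyperbola⁻ {K} {x} {y} xy∈
... | (1≤x , _) , xy≤K = ℕP.≤-trans (ℕP.m≤n*m y x {{ℕ.>-nonZero 1≤x}}) xy≤K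

hyperbolaWithTail-isBoard : ∀ K t → IsBoard (hyperbolaWithTail K t)
hyperbolaWithTail-isBoard K t = unique , All.tabulate cell-positive , closed
  where
  tail = map (tailCell K) (range t)
  disjoint : ∀ {v} → ¬ (v ∈ hyperbola K × v ∈ tail)
  disjoint {x , y} (∈hyp , ∈tail) with ∈-tail⁻ {K} {t} ∈tail
  ... | refl , j , refl , 1≤j , _ = ℕP.<-irrefl refl (ℕP.<-≤-trans (ℕP.≤-trans (ℕP.≤-reflexive (ℕP.+-comm 1 K)) (ℕP.+-monoʳ-≤ K 1≤j)) (y≤K {K} ∈hyp))
  unique = Unique.++⁺ (hyperbola-unique K) (Unique.map⁺ (λ e → ℕP.+-cancelˡ-≡ K _ _ (cong proj₂ e)) (range-unique t)) disjoint
  cell-positive : ∀ {c} → c ∈ hyperbolaWithTail K t → Positive c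
  cell-positive {x , y} c∈ with ∈-++⁻ (hyperbola K) c∈
  ... | inj₁ ∈hyp  = proj₁ (∈-hyperbola⁻ {K} ∈hyp)
  ... | inj₂ ∈tail with ∈-tail⁻ {K} {t} ∈tail
  ... | refl , j , refl , 1≤j , _ = ℕP.≤-refl , ℕP.≤-trans 1≤j (ℕP.m≤n+m j K)
  inFirstRow : ∀ q j → 1 ≤ℕ q → q ≤ℕ K ℕ.+ j → j ≤ℕ t → (1 , q) ∈ hyperbolaWithTail K t
  inFirstRow q j 1≤q q≤K+j j≤t with q ℕP.≤? K
  ... | yes q≤K = ∈-++⁺ˡ (∈-hyperbola⁺ {K} {1} {q} ℕP.≤-refl 1≤q (ℕP.≤-trans (ℕP.≤-reflexive (ℕP.*-identityˡ q)) q≤K))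
  ... | no q≰K with ℕP.m≤n⇒∃[o]m+o≡n (ℕP.<⇒≤ (ℕP.≰⇒> q≰K))
  ... | zero  , K+0≡q with () ← q≰K (ℕP.≤-reflexive (trans (sym K+0≡q) (ℕP.+-identityʳ K)))
  ... | suc o , K+o≡q = ∈-++⁺ʳ (hyperbola K) (subst (_∈ tail) (cong (1 ,_) K+o≡q)
        (∈-map⁺ (tailCell K) (∈-range⁺ (ℕ.s≤s ℕ.z≤n) (ℕP.≤-trans (ℕP.+-cancelˡ-≤ K (suc o) j (subst (_≤ℕ K ℕ.+ j) (sym K+o≡q) q≤K+j)) j≤t))))
  closed : ∀ x y p q → (x , y) ∈ hyperbolaWithTail K t → 1 ≤ℕ p → p ≤ℕ x → 1 ≤ℕ q → q ≤ℕ y → (p , q) ∈ hyperbolaWithTail K t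
  closed x y p q xy∈ 1≤p p≤x 1≤q q≤y with ∈-++⁻ (hyperbola K) xy∈
  ... | inj₁ ∈hyp = ∈-++⁺ˡ (∈-hyperbola⁺ 1≤p 1≤q (ℕP.≤-trans (ℕP.*-mono-≤ p≤x q≤y) (proj₂ (∈-hyperbola⁻ {K} ∈hyp))))
  ... | inj₂ ∈tail with ∈-tail⁻ {K} {t} ∈tail
  ... | refl , j , refl , _ , j≤t with p | 1≤p | p≤x
  ...   | suc zero    | _ | _        = inFirstRow q j 1≤q q≤y j≤t
  ...   | suc (suc _) | _ | ℕ.s≤s ()

κ : ℕ → ℕ
κ N = N ℕ./ ℓ N

heavyBoard : ℕ → List Cell
heavyBoard N = hyperbolaWithTail (κ N) (N ∸ length (hyperbola (κ N)))

κ≤ : ∀ N → κ N ≤ℕ N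
κ≤ N = m/n≤m N (ℓ N)

length-hyperbola-κ≤ : ∀ N → length (hyperbola (κ N)) ≤ℕ N
length-hyperbola-κ≤ N = ⟦⟧-cancel-≤ (begin
  ⟦ length (hyperbola K) ⟧   ≤⟨ length-hyperbola≤ K ⟩
  ⟦ K ⟧ * H K                ≤⟨ *-monoˡ-≤-0≤ ⟦ K ⟧ (⟦⟧-nonNeg K) (≤-trans (H-mono-≤ (κ≤ N)) (H≤ℓ N)) ⟩
  ⟦ K ⟧ * ⟦ ℓ N ⟧            ≡⟨ sym (⟦⟧-* K (ℓ N)) ⟩
  ⟦ K ℕ.* ℓ N ⟧              ≤⟨ ⟦⟧-mono-≤ (m/n*n≤m N (ℓ N)) ⟩
  ⟦ N ⟧                      ∎)
  where
  open ≤-Reasoning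
  K = κ N

heavyBoard-isBoard : ∀ N → IsBoard (heavyBoard N)
heavyBoard-isBoard N = hyperbolaWithTail-isBoard (κ N) (N ∸ length (hyperbola (κ N)))

length-heavyBoard : ∀ N → length (heavyBoard N) ≡ N
length-heavyBoard N = begin
  length (hyperbola K ++ map (tailCell K) (range t))     ≡⟨ length-++ (hyperbola K) ⟩
  length (hyperbola K) ℕ.+ length (map (tailCell K) (range t)) ≡⟨ cong (length (hyperbola K) ℕ.+_) (trans (length-map (tailCell K) (range t)) (length-range t)) ⟩
  length (hyperbola K) ℕ.+ t                              ≡⟨ ℕP.m+[n∸m]≡n (length-hyperbola-κ≤ N) ⟩
  N                                                       ∎
  where
  open ≡-Reasoning
  K = κ N
  t = N ∸ length (hyperbola K)

H≤H-κ+H-ℓ : ∀ N → H N ≤ H (κ N) + H (ℓ N)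
H≤H-κ+H-ℓ N = ≤-trans (H-mono-≤ (≤*suc-column N (suc (ilog₂ N)))) (≤-trans (H-*≤H+H (ℓ N) (κ N)) (≤-reflexive (+-comm (H (ℓ N)) (H (κ N)))))

totalWeight-heavyBoard-lower : ∀ N → ½ * (H N * H N) - H N * H (ℓ N) - ½ * H N ≤ totalWeight (heavyBoard N)
totalWeight-heavyBoard-lower N = begin
  ½ * (H N * H N) - H N * H (ℓ N) - ½ * H N  ≤⟨ +-mono-≤ (½n²-nl≤½k² (H N) (H (ℓ N)) (H K) (H-nonNeg N) (H-nonNeg (ℓ N)) (H-nonNeg K) (H≤H-κ+H-ℓ N))
                                                         (neg-antimono-≤ (*-monoˡ-≤-0≤ ½ 0≤½ (H-mono-≤ (κ≤ N)))) ⟩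
  ½ * (H K * H K) - ½ * H K                  ≤⟨ totalWeight-hyperbola-lower K ⟩
  totalWeight (hyperbola K)                  ≤⟨ ≤-trans (≤-reflexive (sym (+-identityʳ _))) (+-monoʳ-≤ (totalWeight (hyperbola K)) (totalWeight-nonNeg tail)) ⟩
  totalWeight (hyperbola K) + totalWeight tail ≡⟨ sym (∑-++ (hyperbola K) tail weight) ⟩
  totalWeight (heavyBoard N)                 ∎
  where
  open ≤-Reasoning
  K = κ N
  tail = map (tailCell K) (range (N ∸ length (hyperbola K)))

-- The error term

ε : ℕ → ℚ
ε N = (⟦ 2 ⟧ * inv (ℓ N)) * (H (ℓ N) + 1ℚ)

private
  1≤H+1 : ∀ n → 1ℚ ≤ H n + 1ℚ
  1≤H+1 n = ≤-trans (≤-reflexive (sym (+-identityˡ 1ℚ))) (+-monoˡ-≤ 1ℚ (H-nonNeg n))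

  0≤2/ℓ : ∀ N → 0ℚ ≤ ⟦ 2 ⟧ * inv (ℓ N)
  0≤2/ℓ N = 0≤* (⟦⟧-nonNeg 2) (inv-nonNeg (ℓ N))

ε-nonNeg : ∀ N → 0ℚ ≤ ε N
ε-nonNeg N = 0≤* (0≤2/ℓ N) (≤-trans (inv-nonNeg 1) (1≤H+1 (ℓ N)))

-- H+1≤ with s = 4 (d + 1) gives ε ≤ 2 s / ℓ + 2 / s, and both terms are at most 1/(2 (d + 1)).
ε≤inv : ∀ N d → (2 ℕ.* (2 ℕ.* (2 ℕ.* suc d))) ℕ.* (2 ℕ.* suc d) ≤ℕ ℓ N → ε N ≤ inv (suc d)
ε≤inv N d big = begin
  (⟦ 2 ⟧ * inv L) * (H L + 1ℚ)                                 ≤⟨ *-monoˡ-≤-0≤ (⟦ 2 ⟧ * inv L) (0≤2/ℓ N) (H+1≤ L (ℕ.pred s)) ⟩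
  (⟦ 2 ⟧ * inv L) * (⟦ s ⟧ + ⟦ L ⟧ * inv s)                     ≡⟨ solve 5 (λ t i a b j → (t :* i) :* (a :+ b :* j) := (t :* a) :* i :+ t :* j :* (i :* b)) refl ⟦ 2 ⟧ (inv L) ⟦ s ⟧ ⟦ L ⟧ (inv s) ⟩
  (⟦ 2 ⟧ * ⟦ s ⟧) * inv L + ⟦ 2 ⟧ * inv s * (inv L * ⟦ L ⟧)    ≡⟨ cong₂ (λ u v → u * inv L + ⟦ 2 ⟧ * inv s * v) (sym (⟦⟧-* 2 s)) (inv-inverseˡ (suc (ilog₂ N))) ⟩
  ⟦ 2 ℕ.* s ⟧ * inv L + ⟦ 2 ⟧ * inv s * 1ℚ                      ≡⟨ cong (λ z → ⟦ 2 ℕ.* s ⟧ * inv L + z) (trans (*-identityʳ _) (⟦⟧*inv-*-cancel 1 (2 ℕ.* suc d))) ⟩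
  ⟦ 2 ℕ.* s ⟧ * inv L + i                                      ≤⟨ +-monoˡ-≤ i (⟦⟧*inv≤inv (ℕ.pred (2 ℕ.* s)) (ℕ.pred (2 ℕ.* suc d)) L big) ⟩
  i + i                                                        ≡⟨ trans (cong₂ _+_ (inv-* 2 (suc d)) (inv-* 2 (suc d)))
                                                                        (solve 1 (λ x → con ½ :* x :+ con ½ :* x := x) refl (inv (suc d))) ⟩
  inv (suc d)                                                  ∎
  where
  open ≤-Reasoning
  L = ℓ N
  s = 2 ℕ.* (2 ℕ.* suc d)
  i = inv (2 ℕ.* suc d)
  ⟦⟧*inv≤inv : ∀ a e c → suc a ℕ.* suc e ≤ℕ c → ⟦ suc a ⟧ * inv c ≤ inv (suc e)
  ⟦⟧*inv≤inv a e (suc c) ae≤c = ≤-trans (*-monoˡ-≤-0≤ ⟦ suc a ⟧ (⟦⟧-nonNeg (suc a)) (inv-antimono-≤ {e ℕ.+ a ℕ.* suc e} {c} ae≤c))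
                                        (≤-reflexive (⟦⟧*inv-*-cancel a (suc e)))

ε→0 : ∀ δ → 0ℚ < δ → ∃ λ M → ∀ N → M ≤ℕ N → ∣ ε N ∣ ≤ δ
ε→0 δ 0<δ with ∃inv≤ δ 0<δ
... | d , inv≤δ = 2 ^ j , λ N 2^j≤N → ≤-trans (≤-reflexive (0≤p⇒∣p∣≡p (ε-nonNeg N)))
  (≤-trans (ε≤inv N d (ℕP.≤-trans (2^≤⇒≤ilog₂ j N 2^j≤N) (ℕP.≤-trans (ℕP.n≤1+n _) (ℕP.n≤1+n _)))) inv≤δ)
  where j = (2 ℕ.* (2 ℕ.* (2 ℕ.* suc d))) ℕ.* (2 ℕ.* suc d)

-- ε N H N ≥ (2/ℓ N) (½ ℓ N) (H (ℓ N) + 1) ≥ H (ℓ N) + 1.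
[H-ℓ+1]*H≤ε*H² : ∀ N → (H (ℓ N) + 1ℚ) * H N ≤ ε N * (H N * H N)
[H-ℓ+1]*H≤ε*H² zero    = ≤-reflexive (trans (*-zeroʳ (H (ℓ 0) + 1ℚ)) (sym (*-zeroʳ (ε 0))))
[H-ℓ+1]*H≤ε*H² (suc n) = begin
  (H L + 1ℚ) * H N                                ≡⟨ cong ((H L + 1ℚ) *_) (sym (*-identityˡ (H N))) ⟩
  (H L + 1ℚ) * (1ℚ * H N)                         ≤⟨ *-monoˡ-≤-0≤ (H L + 1ℚ) (≤-trans (inv-nonNeg 1) (1≤H+1 L)) (*-monoʳ-≤-0≤ (H N) (H-nonNeg N) 1≤2/ℓ*H) ⟩
  (H L + 1ℚ) * ((⟦ 2 ⟧ * inv L * H N) * H N)      ≡⟨ solve 3 (λ a t h → a :* ((t :* h) :* h) := (t :* a) :* (h :* h)) refl (H L + 1ℚ) (⟦ 2 ⟧ * inv L) (H N) ⟩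
  ε N * (H N * H N)                               ∎
  where
  open ≤-Reasoning
  N = suc n
  L = ℓ N
  1≤2/ℓ*H : 1ℚ ≤ ⟦ 2 ⟧ * inv L * H N
  1≤2/ℓ*H = begin
    1ℚ                                  ≡⟨ sym (trans (solve 4 (λ a i h b → (a :* i) :* (h :* b) := (a :* h) :* (i :* b)) refl ⟦ 2 ⟧ (inv L) ½ ⟦ L ⟧)
                                                      (cong (1ℚ *_) (inv-inverseˡ (suc (ilog₂ N))))) ⟩
    ⟦ 2 ⟧ * inv L * (½ * ⟦ L ⟧)         ≤⟨ *-monoˡ-≤-0≤ (⟦ 2 ⟧ * inv L) (0≤2/ℓ N) (½ℓ≤H n) ⟩
    ⟦ 2 ⟧ * inv L * H N                 ∎

H≤ε*H² : ∀ N → H N ≤ ε N * (H N * H N)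
H≤ε*H² N = ≤-trans (≤-trans (≤-reflexive (sym (*-identityˡ (H N)))) (*-monoʳ-≤-0≤ (H N) (H-nonNeg N) (1≤H+1 (ℓ N)))) ([H-ℓ+1]*H≤ε*H² N)

E-upper : ∀ B → IsBoard B → E B ≤ (½ + ε (length B)) * (H (length B) * H (length B))
E-upper B board = begin
  E B                              ≡⟨ E≡totalWeight B board ⟩
  totalWeight B                    ≤⟨ totalWeight-upper B board ⟩
  ½ * (h * h) + h                  ≤⟨ +-monoʳ-≤ (½ * (h * h)) (H≤ε*H² N) ⟩
  ½ * (h * h) + ε N * (h * h)      ≡⟨ sym (*-distribʳ-+ (h * h) ½ (ε N)) ⟩
  (½ + ε N) * (h * h)              ∎
  where
  open ≤-Reasoning
  N = length B
  h = H N

E-heavyBoard-lower : ∀ N → (½ - ε N) * (H N * H N) ≤ E (heavyBoard N)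
E-heavyBoard-lower N = begin
  (½ - ε N) * (h * h)                            ≡⟨ solve 3 (λ e h c → (c :- e) :* (h :* h) := c :* (h :* h) :- e :* (h :* h)) refl (ε N) h ½ ⟩
  ½ * (h * h) - ε N * (h * h)                    ≤⟨ +-monoʳ-≤ (½ * (h * h)) (neg-antimono-≤ ([H-ℓ+1]*H≤ε*H² N)) ⟩
  ½ * (h * h) - (H (ℓ N) + 1ℚ) * h               ≡⟨ solve 2 (λ h l → con ½ :* (h :* h) :- (l :+ con 1ℚ) :* h := (con ½ :* (h :* h) :- h :* l :- con ½ :* h) :- con ½ :* h) refl h (H (ℓ N)) ⟩
  (½ * (h * h) - h * H (ℓ N) - ½ * h) - ½ * h    ≤⟨ +-monoʳ-≤ (½ * (h * h) - h * H (ℓ N) - ½ * h) (neg-antimono-≤ (0≤* 0≤½ (H-nonNeg N))) ⟩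
  (½ * (h * h) - h * H (ℓ N) - ½ * h) - 0ℚ       ≡⟨ +-identityʳ _ ⟩
  ½ * (h * h) - h * H (ℓ N) - ½ * h              ≤⟨ totalWeight-heavyBoard-lower N ⟩
  totalWeight (heavyBoard N)                     ≡⟨ sym (E≡totalWeight (heavyBoard N) (heavyBoard-isBoard N)) ⟩
  E (heavyBoard N)                               ∎
  where
  open ≤-Reasoning
  h = H N

open import Data.Integer using (+_)

theorem2 :
    Σ (ℕ → ℚ) λ ε →
      (∀ (δ : ℚ) → 0ℚ < δ → ∃ λ M → ∀ N → M ≤ℕ N → ∣ ε N ∣ ≤ δ)
      × (∀ (B : List Cell) → IsBoard B →
           (H (length B) ≤ E B)
           × (E B ≤ (((+ 1 / 2) + ε (length B)) * (H (length B) * H (length B)))))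
      × (∀ (N : ℕ) → Σ (List Cell) λ B → IsBoard B × (length B ≡ N) × (E B ≡ H N))
      × (∀ (N : ℕ) → Σ (List Cell) λ B → IsBoard B × (length B ≡ N)
           × ((((+ 1 / 2) - ε N) * (H N * H N)) ≤ E B))
theorem2 =
  ε , ε→0 ,
  (λ B board → ≤-trans (H≤totalWeight (length B) B board refl) (≤-reflexive (sym (E≡totalWeight B board)))
             , E-upper B board) ,
  (λ N → row N , row-isBoard N , length-row N , trans (E≡totalWeight (row N) (row-isBoard N)) (totalWeight-row N)) ,
  (λ N → heavyBoard N , heavyBoard-isBoard N , length-heavyBoard N , E-heavyBoard-lower N)
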